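{- Let $a,b$ be coprime integers with $1\le a\le b$, and let $A_{ij}$ be the coefficient of $u^iv^jw^{a+b-1-i-j}$ in the numerator $P_{a/b}(u,v,w)$ of the Markov polynomial $M_{a/b}$. Let $\Delta_{a/b}$ be the set of integer points $(i,j)$ with $i,j\ge0$, $\frac ia+\frac jb\ge1$, $i+j\le a+b-1$. Then the sequence of coefficients $A_{ij}$ at the consecutive points of $\Delta_{a/b}$ on the line $j=1$, and the sequence of coefficients at the consecutive points of $\Delta_{a/b}$ on the line $i+j=a+b-2$, are each strictly log-concave.
   Context: A sequence $(x_0,\dots,x_m)$ is strictly log-concave if $x_k^2> x_{k-1}x_{k+1}$ for all $1\le k\le m-1$. Markov polynomials $M_\rho(x,y,z)$, $\rho\in\mathbb{Q}_{\ge0}\cup\{1/0\}$, are defined recursively by $M_{0/1}=x$, $M_{1/0}=y$, $M_{1/1}=(x^2+y^2)/z$, and: whenever $p/q$, $r/s$ are fractions in lowest terms with $p,q,r,s\ge0$, $qr-ps=1$, mediant $\mu=(p+r)/(q+s)$, then $M_{(2p+r)/(2q+s)}=(M_{p/q}^2+M_\mu^2)/M_{r/s}$ and $M_{(p+2r)/(q+2s)}=(M_\mu^2+M_{r/s}^2)/M_{p/q}$. For coprime positive $a,b$, $M_{a/b}=P_{a/b}(x^2,y^2,z^2)/(x^{a-1}y^{b-1}z^{a+b-1})$ with $P_{a/b}(u,v,w)$ homogeneous of degree $a+b-1$ (the numerator). -}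

module Defs where

open import Data.Nat as ℕ using (ℕ; zero; suc; _∸_; _≤?_; _≟_)
open import Data.Integer as ℤ using (ℤ; 0ℤ; 1ℤ)
open import Data.Product using (_×_)
open import Data.Unit using (⊤)
open import Data.List using (List; []; _∷_; map; filter; upTo)
open import Relation.Nullary using (Dec; yes; no)
open import Relation.Nullary.Decidable using (_×-dec_)
open import Relation.Binary.PropositionalEquality using (_≡_)

-- Formal power series in three variables u, v, w over ℤ:
-- S i j k is the coefficient of u^i v^j w^k.  Polynomials embed
-- (finite support); the ring of power series is an integral domain,
-- so exact division identities determine quotients uniquely.
Ser : Set
Ser = ℕ → ℕ → ℕ → ℤ

_≈_ : Ser → Ser → Set
f ≈ g = ∀ i j k → f i j k ≡ g i j k
infix 4 _≈_

sumTo : ℕ → (ℕ → ℤ) → ℤ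
sumTo zero    f = f 0
sumTo (suc n) f = sumTo n f ℤ.+ f (suc n)

_⊕_ : Ser → Ser → Ser
(f ⊕ g) i j k = f i j k ℤ.+ g i j k
infixl 6 _⊕_

_⊗_ : Ser → Ser → Ser
(f ⊗ g) i j k =
  sumTo i λ i₁ → sumTo j λ j₁ → sumTo k λ k₁ →
    f i₁ j₁ k₁ ℤ.* g (i ∸ i₁) (j ∸ j₁) (k ∸ k₁)
infixl 7 _⊗_

mono : ℕ → ℕ → ℕ → Ser
mono a b c i j k with i ≟ a | j ≟ b | k ≟ c
... | yes _ | yes _ | yes _ = 1ℤ
... | _     | _     | _     = 0ℤ

-- P : ℕ → ℕ → Ser, with P p q the numerator P_{p/q}(u,v,w) of M_{p/q}
-- (M_{p/q} = P_{p/q}(x²,y²,z²) / (x^{p-1} y^{q-1} z^{p+q-1})).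
-- Multiplying the defining recursions of M by the denominators gives:
--   P_{(2p+r)/(2q+s)} P_{r/s} = u^r v^s w^{r+s} P_{p/q}² + P_μ²
--   P_{(p+2r)/(q+2s)} P_{p/q} = P_μ² + u^p v^q w^{p+q} P_{r/s}²
-- with P_{0/1} = P_{1/0} = 1 and P_{1/1} = u + v.
IsMarkovNumerators : (ℕ → ℕ → Ser) → Set
IsMarkovNumerators P =
  (P 0 1 ≈ mono 0 0 0) × (P 1 0 ≈ mono 0 0 0) × (P 1 1 ≈ mono 1 0 0 ⊕ mono 0 1 0) ×
  (∀ p q r s → q ℕ.* r ≡ p ℕ.* s ℕ.+ 1 →
     P (2 ℕ.* p ℕ.+ r) (2 ℕ.* q ℕ.+ s) ⊗ P r s
       ≈ mono r s (r ℕ.+ s) ⊗ (P p q ⊗ P p q) ⊕ P (p ℕ.+ r) (q ℕ.+ s) ⊗ P (p ℕ.+ r) (q ℕ.+ s)) ×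
  (∀ p q r s → q ℕ.* r ≡ p ℕ.* s ℕ.+ 1 →
     P (p ℕ.+ 2 ℕ.* r) (q ℕ.+ 2 ℕ.* s) ⊗ P p q
       ≈ P (p ℕ.+ r) (q ℕ.+ s) ⊗ P (p ℕ.+ r) (q ℕ.+ s) ⊕ mono p q (p ℕ.+ q) ⊗ (P r s ⊗ P r s))

coeffA : (ℕ → ℕ → Ser) → ℕ → ℕ → ℕ → ℕ → ℤ
coeffA P a b i j = P a b i j (a ℕ.+ b ∸ 1 ∸ i ∸ j)

InΔ : ℕ → ℕ → ℕ → ℕ → Set
InΔ a b i j = (a ℕ.* b ℕ.≤ b ℕ.* i ℕ.+ a ℕ.* j) × (i ℕ.+ j ℕ.≤ a ℕ.+ b ∸ 1)

InΔ? : ∀ a b i j → Dec (InΔ a b i j)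
InΔ? a b i j = (a ℕ.* b ≤? b ℕ.* i ℕ.+ a ℕ.* j) ×-dec (i ℕ.+ j ≤? a ℕ.+ b ∸ 1)

line1 : ℕ → ℕ → List ℕ
line1 a b = filter (λ i → InΔ? a b i 1) (upTo (a ℕ.+ b))

InLine2 : ℕ → ℕ → ℕ → Set
InLine2 a b i = (i ℕ.≤ a ℕ.+ b ∸ 2) × InΔ a b i (a ℕ.+ b ∸ 2 ∸ i)

InLine2? : ∀ a b i → Dec (InLine2 a b i)
InLine2? a b i = (i ≤? a ℕ.+ b ∸ 2) ×-dec InΔ? a b i (a ℕ.+ b ∸ 2 ∸ i)

line2 : ℕ → ℕ → List ℕ
line2 a b = filter (InLine2? a b) (upTo (a ℕ.+ b))

seq1 : (ℕ → ℕ → Ser) → ℕ → ℕ → List ℤ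
seq1 P a b = map (λ i → coeffA P a b i 1) (line1 a b)

seq2 : (ℕ → ℕ → Ser) → ℕ → ℕ → List ℤ
seq2 P a b = map (λ i → coeffA P a b i (a ℕ.+ b ∸ 2 ∸ i)) (line2 a b)

StrictlyLogConcave : List ℤ → Set
StrictlyLogConcave (x ∷ y ∷ z ∷ xs) = (x ℤ.* z ℤ.< y ℤ.* y) × StrictlyLogConcave (y ∷ z ∷ xs)
StrictlyLogConcave _ = ⊤

-- Write S₀, S₁ for the coefficients of v⁰, v¹ in P_{a/b} (resp. of w⁰, w¹, in which case
-- the second variable below is v instead of w); the coefficients along the line j = 1
-- (resp. i + j = a + b − 2) are those of S₁.  For 0 < a/b < 1 these slices have the shape
--   (u + w) S₀ = uˣ (u + w)ʸ,   (u + w)³ S₁ = uˣ (u + w)ʸ (α w + β u)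
-- with (x, y, α, β) = (a, b, 3a − 1, a + b − 1) for v and (0, a + b, a − 1, b − 1) for w.
-- These data are affine in (a, b), so they respect c + G = 2μ, and slicing a Markov
-- recursion P_c P_G = P_μ² + (monomial) P_L² at orders 0 and 1 determines the slices of P_c
-- from those of G and μ after cancelling the common factors uˣ (u + w)ʸ.  So the shape
-- propagates down the Stern–Brocot tree below (0/1, 1/1); where G is a boundary fraction
-- (0/1, or 1/1 for v) whose order-1 slice misses the shape, the monomial term makes up the
-- difference exactly.  Hence S₁ = uˣ (u + w)ʸ⁻³ (α w + β u), so both sequences are iterated
-- Pascal transforms x ↦ x_{j−1} + x_j of the positive pair (α, β) (of (β) alone when a = 1
-- on the second line), and such transforms preserve strict log-concavity.

module Submission where

open import Defs
open import Data.Nat using (ℕ; zero; suc; _+_; _*_; _∸_; _≤_; _<_; _≟_; _<?_; _≤?_; z≤n; s≤s; >-nonZero)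
import Data.Nat.Properties as ℕₚ
import Data.Nat.Tactic.RingSolver as ℕ-Solver
open import Data.Nat.Coprimality using (Coprime)
import Data.Nat.Coprimality as Coprime
open import Data.Nat.Divisibility using (_∣_; ∣-refl; ∣m∣n⇒∣m+n)
open import Data.Integer as ℤ using (ℤ; 0ℤ; 1ℤ; +<+)
  renaming (_+_ to _+ᶻ_; _*_ to _*ᶻ_; -_ to -ᶻ_; _-_ to _-ᶻ_)
import Data.Integer.Properties as ℤₚ
open import Data.Integer.Tactic.RingSolver using (solve-∀)
open import Algebra.Properties.AbelianGroup ℤₚ.+-0-abelianGroup using ()
  renaming (∙-cancelˡ to +ᶻ-cancelˡ)
open import Algebra.Properties.CommutativeSemigroup ℕₚ.+-commutativeSemigroup using ()
  renaming (interchange to +-interchange)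
open import Algebra.Properties.CommutativeSemigroup ℤₚ.+-commutativeSemigroup using ()
  renaming (interchange to +ᶻ-interchange)
open import Data.List using ([]; _∷_; _++_; map; filter; upTo; applyUpTo)
open import Data.List.Properties using (filter-++; filter-all; filter-none; ++-identityʳ; map-applyUpTo)
open import Data.List.Relation.Unary.All using ([]; _∷_)
open import Data.List.Relation.Unary.All.Properties using (applyUpTo⁺₁)
open import Data.Product using (_×_; _,_; proj₁; proj₂)
open import Data.Sum using (inj₁; inj₂)
open import Data.Unit using (tt)
open import Function using (_∘_)
open import Relation.Binary using (tri<; tri≈; tri>)
open import Relation.Binary.Bundles using (Setoid)
open import Relation.Binary.PropositionalEquality
  using (_≡_; refl; sym; trans; cong; cong₂; subst; subst₂; module ≡-Reasoning)
import Relation.Binary.Reasoning.Setoid as SetoidReasoning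
open import Relation.Nullary using (¬_; yes; no)
open import Relation.Nullary.Negation using (contradiction)
open import Relation.Unary using (Pred; Decidable)

-- Power series in two variables

sumTo-cong : ∀ n {f g : ℕ → ℤ} → (∀ t → t ≤ n → f t ≡ g t) → sumTo n f ≡ sumTo n g
sumTo-cong zero    f≗g = f≗g 0 z≤n
sumTo-cong (suc n) f≗g =
  cong₂ _+ᶻ_ (sumTo-cong n λ t t≤n → f≗g t (ℕₚ.m≤n⇒m≤1+n t≤n)) (f≗g (suc n) ℕₚ.≤-refl)

sumTo-+ : ∀ n (f g : ℕ → ℤ) → sumTo n (λ t → f t +ᶻ g t) ≡ sumTo n f +ᶻ sumTo n g
sumTo-+ zero    f g = refl
sumTo-+ (suc n) f g = trans (cong (_+ᶻ (f (suc n) +ᶻ g (suc n))) (sumTo-+ n f g))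
                            (+ᶻ-interchange (sumTo n f) (sumTo n g) (f (suc n)) (g (suc n)))

sumTo-zero : ∀ n {f : ℕ → ℤ} → (∀ t → t ≤ n → f t ≡ 0ℤ) → sumTo n f ≡ 0ℤ
sumTo-zero zero    f≗0 = f≗0 0 z≤n
sumTo-zero (suc n) f≗0 =
  cong₂ _+ᶻ_ (sumTo-zero n λ t t≤n → f≗0 t (ℕₚ.m≤n⇒m≤1+n t≤n)) (f≗0 (suc n) ℕₚ.≤-refl)

sumTo-sucˡ : ∀ n (f : ℕ → ℤ) → sumTo (suc n) f ≡ f 0 +ᶻ sumTo n (f ∘ suc)
sumTo-sucˡ zero    f = refl
sumTo-sucˡ (suc n) f = trans (cong (_+ᶻ f (suc (suc n))) (sumTo-sucˡ n f)) (ℤₚ.+-assoc (f 0) _ _)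

sumTo-head : ∀ n {f : ℕ → ℤ} → (∀ t → f (suc t) ≡ 0ℤ) → sumTo n f ≡ f 0
sumTo-head zero    f≗0 = refl
sumTo-head (suc n) {f} f≗0 = begin
  sumTo (suc n) f              ≡⟨ sumTo-sucˡ n f ⟩
  f 0 +ᶻ sumTo n (f ∘ suc)     ≡⟨ cong (f 0 +ᶻ_) (sumTo-zero n λ t _ → f≗0 t) ⟩
  f 0 +ᶻ 0ℤ                    ≡⟨ ℤₚ.+-identityʳ (f 0) ⟩
  f 0                          ∎
  where open ≡-Reasoning

sumTo-last : ∀ n {f : ℕ → ℤ} → (∀ t → t < n → f t ≡ 0ℤ) → sumTo n f ≡ f n
sumTo-last zero    f≗0 = refl
sumTo-last (suc n) {f} f≗0 =
  trans (cong (_+ᶻ f (suc n)) (sumTo-zero n λ t t≤n → f≗0 t (s≤s t≤n))) (ℤₚ.+-identityˡ (f (suc n)))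

Ser₂ : Set
Ser₂ = ℕ → ℕ → ℤ

infix 4 _≋_
record _≋_ (F G : Ser₂) : Set where
  constructor pointwise
  field at : ∀ i k → F i k ≡ G i k
open _≋_ public

≋-setoid : Setoid _ _
≋-setoid = record
  { Carrier       = Ser₂
  ; _≈_           = _≋_
  ; isEquivalence = record
    { refl  = pointwise λ i k → refl
    ; sym   = λ F≋G → pointwise λ i k → sym (at F≋G i k)
    ; trans = λ F≋G G≋H → pointwise λ i k → trans (at F≋G i k) (at G≋H i k)
    }
  }

open Setoid ≋-setoid public using () renaming (refl to ≋-refl; reflexive to ≋-reflexive; sym to ≋-sym; trans to ≋-trans)
module ≋-Reasoning = SetoidReasoning ≋-setoid

infixl 6 _⊞_
infixl 7 _⊛_

_⊞_ : Ser₂ → Ser₂ → Ser₂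
(F ⊞ G) i k = F i k +ᶻ G i k

_⊛_ : Ser₂ → Ser₂ → Ser₂
(F ⊛ G) i k = sumTo i λ i₁ → sumTo k λ k₁ → F i₁ k₁ *ᶻ G (i ∸ i₁) (k ∸ k₁)

𝟘 : Ser₂
𝟘 _ _ = 0ℤ

const : ℤ → Ser₂
const c zero zero = c
const c _    _    = 0ℤ

one : Ser₂
one = const 1ℤ

-- The linear form α·w + β·u, u and w being the two variables of Ser₂.
lin : ℤ → ℤ → Ser₂
lin α β zero       (suc zero) = α
lin α β (suc zero) zero       = β
lin α β _          _          = 0ℤ

-- U, W and T are multiplication by u, by w and by u + w.
U W T : Ser₂ → Ser₂
U F zero    k = 0ℤ
U F (suc i) k = F i k
W F i zero    = 0ℤ
W F i (suc k) = F i k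
T F = U F ⊞ W F

infixr 8 _^_
_^_ : (Ser₂ → Ser₂) → ℕ → Ser₂ → Ser₂
(D ^ zero)  F = F
(D ^ suc n) F = D ((D ^ n) F)

UT : ℕ → ℕ → Ser₂ → Ser₂
UT x y F = (U ^ x) ((T ^ y) F)

⊞-cong : ∀ {F F′ G G′} → F ≋ F′ → G ≋ G′ → F ⊞ G ≋ F′ ⊞ G′
⊞-cong F≋F′ G≋G′ = pointwise λ i k → cong₂ _+ᶻ_ (at F≋F′ i k) (at G≋G′ i k)

⊞-congˡ : ∀ F {G G′} → G ≋ G′ → F ⊞ G ≋ F ⊞ G′
⊞-congˡ F = ⊞-cong (≋-refl {F})

⊞-congʳ : ∀ G {F F′} → F ≋ F′ → F ⊞ G ≋ F′ ⊞ G
⊞-congʳ G F≋F′ = ⊞-cong F≋F′ (≋-refl {G})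

⊞-comm : ∀ F G → F ⊞ G ≋ G ⊞ F
⊞-comm F G = pointwise λ i k → ℤₚ.+-comm (F i k) (G i k)

⊞-identityˡ : ∀ F → 𝟘 ⊞ F ≋ F
⊞-identityˡ F = pointwise λ i k → ℤₚ.+-identityˡ (F i k)

⊞-identityʳ : ∀ F → F ⊞ 𝟘 ≋ F
⊞-identityʳ F = pointwise λ i k → ℤₚ.+-identityʳ (F i k)

⊛-cong : ∀ {F F′ G G′} → F ≋ F′ → G ≋ G′ → F ⊛ G ≋ F′ ⊛ G′
⊛-cong F≋F′ G≋G′ = pointwise λ i k → sumTo-cong i λ i₁ _ → sumTo-cong k λ k₁ _ →
  cong₂ _*ᶻ_ (at F≋F′ i₁ k₁) (at G≋G′ (i ∸ i₁) (k ∸ k₁))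

⊛-congˡ : ∀ F {G G′} → G ≋ G′ → F ⊛ G ≋ F ⊛ G′
⊛-congˡ F = ⊛-cong (≋-refl {F})

⊛-congʳ : ∀ G {F F′} → F ≋ F′ → F ⊛ G ≋ F′ ⊛ G
⊛-congʳ G F≋F′ = ⊛-cong F≋F′ (≋-refl {G})

⊛-distribʳ : ∀ F G H → (F ⊞ G) ⊛ H ≋ F ⊛ H ⊞ G ⊛ H
⊛-distribʳ F G H = pointwise λ i k →
  trans (sumTo-cong i λ t _ → trans (sumTo-cong k λ k₁ _ → ℤₚ.*-distribʳ-+ (H (i ∸ t) (k ∸ k₁)) (F t k₁) (G t k₁))
                                    (sumTo-+ k _ _))
        (sumTo-+ i _ _)

⊛-distribˡ : ∀ F G H → F ⊛ (G ⊞ H) ≋ F ⊛ G ⊞ F ⊛ H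
⊛-distribˡ F G H = pointwise λ i k →
  trans (sumTo-cong i λ t _ → trans (sumTo-cong k λ k₁ _ →
                                       ℤₚ.*-distribˡ-+ (F t k₁) (G (i ∸ t) (k ∸ k₁)) (H (i ∸ t) (k ∸ k₁)))
                                    (sumTo-+ k _ _))
        (sumTo-+ i _ _)

⊛-zeroˡ : ∀ G → 𝟘 ⊛ G ≋ 𝟘
⊛-zeroˡ G = pointwise λ i k → sumTo-zero i λ _ _ → sumTo-zero k λ _ _ → refl

⊛-zeroʳ : ∀ F → F ⊛ 𝟘 ≋ 𝟘
⊛-zeroʳ F = pointwise λ i k → sumTo-zero i λ t _ → sumTo-zero k λ k₁ _ → ℤₚ.*-zeroʳ (F t k₁)

⊛-identityˡ : ∀ G → one ⊛ G ≋ G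
⊛-identityˡ G = pointwise λ i k →
  trans (sumTo-head i λ t → sumTo-zero k λ _ _ → refl)
        (trans (sumTo-head k λ t → refl) (ℤₚ.*-identityˡ (G i k)))

const-vanishesˡ : ∀ c {i} k → 0 < i → const c i k ≡ 0ℤ
const-vanishesˡ c {suc i} k _ = refl

const-vanishesʳ : ∀ c i {k} → 0 < k → const c i k ≡ 0ℤ
const-vanishesʳ c zero    {suc k} _ = refl
const-vanishesʳ c (suc i)         _ = refl

⊛-identityʳ : ∀ F → F ⊛ one ≋ F
⊛-identityʳ F = pointwise λ i k → begin
  (F ⊛ one) i k
    ≡⟨ sumTo-last i (λ t t<i → sumTo-zero k λ k₁ _ →
         trans (cong (F t k₁ *ᶻ_) (const-vanishesˡ 1ℤ (k ∸ k₁) (ℕₚ.m<n⇒0<n∸m t<i))) (ℤₚ.*-zeroʳ (F t k₁))) ⟩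
  sumTo k (λ k₁ → F i k₁ *ᶻ one (i ∸ i) (k ∸ k₁))
    ≡⟨ sumTo-last k (λ t t<k →
         trans (cong (F i t *ᶻ_) (const-vanishesʳ 1ℤ (i ∸ i) (ℕₚ.m<n⇒0<n∸m t<k))) (ℤₚ.*-zeroʳ (F i t))) ⟩
  F i k *ᶻ one (i ∸ i) (k ∸ k)
    ≡⟨ cong₂ (λ m n → F i k *ᶻ one m n) (ℕₚ.n∸n≡0 i) (ℕₚ.n∸n≡0 k) ⟩
  F i k *ᶻ 1ℤ
    ≡⟨ ℤₚ.*-identityʳ (F i k) ⟩
  F i k ∎
  where open ≡-Reasoning

U-⊛ˡ : ∀ F G → U F ⊛ G ≋ U (F ⊛ G)
U-⊛ˡ F G = pointwise λ
  { zero    k → sumTo-zero k λ _ _ → refl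
  ; (suc i) k → trans (sumTo-sucˡ i _)
                      (trans (cong (_+ᶻ (F ⊛ G) i k) (sumTo-zero k λ _ _ → refl)) (ℤₚ.+-identityˡ _))
  }

W-⊛ˡ : ∀ F G → W F ⊛ G ≋ W (F ⊛ G)
W-⊛ˡ F G = pointwise λ
  { i zero    → sumTo-zero i λ _ _ → refl
  ; i (suc k) → sumTo-cong i λ t _ → trans (sumTo-sucˡ k _) (ℤₚ.+-identityˡ _)
  }

U-⊛ʳ : ∀ F G → F ⊛ U G ≋ U (F ⊛ G)
U-⊛ʳ F G = pointwise λ
  { zero    k → sumTo-zero k λ k₁ _ → ℤₚ.*-zeroʳ (F 0 k₁)
  ; (suc i) k → trans
      (cong₂ _+ᶻ_ (sumTo-cong i λ t t≤i → sumTo-cong k λ k₁ _ →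
                     cong (λ m → F t k₁ *ᶻ U G m (k ∸ k₁)) (ℕₚ.+-∸-assoc 1 t≤i))
                  (sumTo-zero k λ k₁ _ →
                     trans (cong (λ m → F (suc i) k₁ *ᶻ U G m (k ∸ k₁)) (ℕₚ.n∸n≡0 (suc i))) (ℤₚ.*-zeroʳ (F (suc i) k₁))))
      (ℤₚ.+-identityʳ _)
  }

W-⊛ʳ : ∀ F G → F ⊛ W G ≋ W (F ⊛ G)
W-⊛ʳ F G = pointwise λ
  { i zero    → sumTo-zero i λ t _ → ℤₚ.*-zeroʳ (F t 0)
  ; i (suc k) → sumTo-cong i λ t _ → trans
      (cong₂ _+ᶻ_ (sumTo-cong k λ k₁ k₁≤k → cong (λ m → F t k₁ *ᶻ W G (i ∸ t) m) (ℕₚ.+-∸-assoc 1 k₁≤k))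
                  (trans (cong (λ m → F t (suc k) *ᶻ W G (i ∸ t) m) (ℕₚ.n∸n≡0 (suc k))) (ℤₚ.*-zeroʳ (F t (suc k)))))
      (ℤₚ.+-identityʳ _)
  }

record IsMultiplier (D : Ser₂ → Ser₂) : Set where
  field
    resp-≋  : ∀ {F G} → F ≋ G → D F ≋ D G
    distrib : ∀ F G → D (F ⊞ G) ≋ D F ⊞ D G
    ⊛ˡ      : ∀ F G → D F ⊛ G ≋ D (F ⊛ G)
    ⊛ʳ      : ∀ F G → F ⊛ D G ≋ D (F ⊛ G)

U-isMultiplier : IsMultiplier U
U-isMultiplier = record
  { resp-≋  = λ F≋G → pointwise λ { zero k → refl ; (suc i) k → at F≋G i k }
  ; distrib = λ F G → pointwise λ { zero k → refl ; (suc i) k → refl }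
  ; ⊛ˡ      = U-⊛ˡ
  ; ⊛ʳ      = U-⊛ʳ
  }

W-isMultiplier : IsMultiplier W
W-isMultiplier = record
  { resp-≋  = λ F≋G → pointwise λ { i zero → refl ; i (suc k) → at F≋G i k }
  ; distrib = λ F G → pointwise λ { i zero → refl ; i (suc k) → refl }
  ; ⊛ˡ      = W-⊛ˡ
  ; ⊛ʳ      = W-⊛ʳ
  }

module _ {D} (isD : IsMultiplier D) where
  open IsMultiplier isD

  multiplier-𝟘 : D 𝟘 ≋ 𝟘
  multiplier-𝟘 = begin
    D 𝟘            ≈⟨ resp-≋ (⊛-zeroʳ one) ⟨
    D (one ⊛ 𝟘)    ≈⟨ ⊛ˡ one 𝟘 ⟨
    D one ⊛ 𝟘      ≈⟨ ⊛-zeroʳ (D one) ⟩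
    𝟘              ∎
    where open ≋-Reasoning

  multipliers-commute : ∀ {E} → IsMultiplier E → ∀ F → D (E F) ≋ E (D F)
  multipliers-commute {E} isE F = begin
    D (E F)          ≈⟨ resp-≋ (E.resp-≋ (⊛-identityˡ F)) ⟨
    D (E (one ⊛ F))  ≈⟨ resp-≋ (E.⊛ˡ one F) ⟨
    D (E one ⊛ F)    ≈⟨ ⊛ʳ (E one) F ⟨
    E one ⊛ D F      ≈⟨ E.⊛ˡ one (D F) ⟩
    E (one ⊛ D F)    ≈⟨ E.resp-≋ (⊛-identityˡ (D F)) ⟩
    E (D F)          ∎
    where
    open ≋-Reasoning
    module E = IsMultiplier isE

⊞-isMultiplier : ∀ {D E} → IsMultiplier D → IsMultiplier E → IsMultiplier (λ F → D F ⊞ E F)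
⊞-isMultiplier {D} {E} isD isE = record
  { resp-≋  = λ F≋G → ⊞-cong (D.resp-≋ F≋G) (E.resp-≋ F≋G)
  ; distrib = λ F G → ≋-trans (⊞-cong (D.distrib F G) (E.distrib F G))
                              (pointwise λ i k → +ᶻ-interchange (D F i k) (D G i k) (E F i k) (E G i k))
  ; ⊛ˡ      = λ F G → ≋-trans (⊛-distribʳ (D F) (E F) G) (⊞-cong (D.⊛ˡ F G) (E.⊛ˡ F G))
  ; ⊛ʳ      = λ F G → ≋-trans (⊛-distribˡ F (D G) (E G)) (⊞-cong (D.⊛ʳ F G) (E.⊛ʳ F G))
  }
  where
  module D = IsMultiplier isD
  module E = IsMultiplier isE

∘-isMultiplier : ∀ {D E} → IsMultiplier D → IsMultiplier E → IsMultiplier (D ∘ E)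
∘-isMultiplier {D} {E} isD isE = record
  { resp-≋  = D.resp-≋ ∘ E.resp-≋
  ; distrib = λ F G → ≋-trans (D.resp-≋ (E.distrib F G)) (D.distrib (E F) (E G))
  ; ⊛ˡ      = λ F G → ≋-trans (D.⊛ˡ (E F) G) (D.resp-≋ (E.⊛ˡ F G))
  ; ⊛ʳ      = λ F G → ≋-trans (D.⊛ʳ F (E G)) (D.resp-≋ (E.⊛ʳ F G))
  }
  where
  module D = IsMultiplier isD
  module E = IsMultiplier isE

^-isMultiplier : ∀ {D} → IsMultiplier D → ∀ n → IsMultiplier (D ^ n)
^-isMultiplier isD zero = record
  { resp-≋ = λ F≋G → F≋G ; distrib = λ _ _ → ≋-refl ; ⊛ˡ = λ _ _ → ≋-refl ; ⊛ʳ = λ _ _ → ≋-refl }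
^-isMultiplier isD (suc n) = ∘-isMultiplier isD (^-isMultiplier isD n)

T-isMultiplier : IsMultiplier T
T-isMultiplier = ⊞-isMultiplier U-isMultiplier W-isMultiplier

UT-isMultiplier : ∀ x y → IsMultiplier (UT x y)
UT-isMultiplier x y = ∘-isMultiplier (^-isMultiplier U-isMultiplier x) (^-isMultiplier T-isMultiplier y)

^-+ : ∀ D m n F → (D ^ m) ((D ^ n) F) ≡ (D ^ (m + n)) F
^-+ D zero    n F = refl
^-+ D (suc m) n F = cong D (^-+ D m n F)

U-injective : ∀ {F G} → U F ≋ U G → F ≋ G
U-injective UF≋UG = pointwise λ i k → at UF≋UG (suc i) k

-- (T F) (1 + i) (1 + k) = F i (1 + k) + F (1 + i) k recovers row 1 + i of F from row i.
T-injective : ∀ {F G} → T F ≋ T G → F ≋ G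
T-injective {F} {G} TF≋TG = pointwise rows
  where
  rows : ∀ i k → F i k ≡ G i k
  rows zero    k = trans (sym (ℤₚ.+-identityˡ (F 0 k))) (trans (at TF≋TG 0 (suc k)) (ℤₚ.+-identityˡ (G 0 k)))
  rows (suc i) k = +ᶻ-cancelˡ (F i (suc k)) (F (suc i) k) (G (suc i) k)
    (trans (at TF≋TG (suc i) (suc k)) (cong (_+ᶻ G (suc i) k) (sym (rows i (suc k)))))

^-injective : ∀ {D} → (∀ {F G} → D F ≋ D G → F ≋ G) → ∀ n {F G} → (D ^ n) F ≋ (D ^ n) G → F ≋ G
^-injective D-inj zero    eq = eq
^-injective D-inj (suc n) eq = ^-injective D-inj n (D-inj eq)

UT-injective : ∀ x y {F G} → UT x y F ≋ UT x y G → F ≋ G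
UT-injective x y = ^-injective T-injective y ∘ ^-injective U-injective x

UT-≡ : ∀ {x y x′ y′} F → x ≡ x′ → y ≡ y′ → UT x y F ≋ UT x′ y′ F
UT-≡ F refl refl = ≋-refl

UT-UT : ∀ x y x′ y′ F → UT x y (UT x′ y′ F) ≋ UT (x + x′) (y + y′) F
UT-UT x y x′ y′ F = begin
  (U ^ x) ((T ^ y) ((U ^ x′) ((T ^ y′) F)))
    ≈⟨ IsMultiplier.resp-≋ (^-isMultiplier U-isMultiplier x)
         (multipliers-commute (^-isMultiplier T-isMultiplier y) (^-isMultiplier U-isMultiplier x′) _) ⟩
  (U ^ x) ((U ^ x′) ((T ^ y) ((T ^ y′) F)))
    ≡⟨ cong (U ^ x) (cong (U ^ x′) (^-+ T y y′ F)) ⟩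
  (U ^ x) ((U ^ x′) ((T ^ (y + y′)) F))
    ≡⟨ ^-+ U x x′ _ ⟩
  UT (x + x′) (y + y′) F ∎
  where open ≋-Reasoning

UT-⊛ : ∀ x y x′ y′ F G → UT x y F ⊛ UT x′ y′ G ≋ UT (x + x′) (y + y′) (F ⊛ G)
UT-⊛ x y x′ y′ F G = begin
  UT x y F ⊛ UT x′ y′ G      ≈⟨ ⊛ˡ F (UT x′ y′ G) ⟩
  UT x y (F ⊛ UT x′ y′ G)    ≈⟨ resp-≋ (IsMultiplier.⊛ʳ (UT-isMultiplier x′ y′) F G) ⟩
  UT x y (UT x′ y′ (F ⊛ G))  ≈⟨ UT-UT x y x′ y′ (F ⊛ G) ⟩
  UT (x + x′) (y + y′) (F ⊛ G) ∎
  where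
  open ≋-Reasoning
  open IsMultiplier (UT-isMultiplier x y)

T^-UT : ∀ n x y F → (T ^ n) (UT x y F) ≋ UT x (n + y) F
T^-UT n x y F = ≋-trans
  (multipliers-commute (^-isMultiplier T-isMultiplier n) (^-isMultiplier U-isMultiplier x) _)
  (≋-reflexive (cong (U ^ x) (^-+ T n y F)))

T^-⊛ : ∀ m n F G → (T ^ (m + n)) (F ⊛ G) ≋ (T ^ m) F ⊛ (T ^ n) G
T^-⊛ m n F G = begin
  (T ^ (m + n)) (F ⊛ G)      ≡⟨ ^-+ T m n (F ⊛ G) ⟨
  (T ^ m) ((T ^ n) (F ⊛ G))  ≈⟨ Tᵐ.resp-≋ (Tⁿ.⊛ʳ F G) ⟨
  (T ^ m) (F ⊛ (T ^ n) G)    ≈⟨ Tᵐ.⊛ˡ F ((T ^ n) G) ⟨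
  (T ^ m) F ⊛ (T ^ n) G      ∎
  where
  open ≋-Reasoning
  module Tᵐ = IsMultiplier (^-isMultiplier T-isMultiplier m)
  module Tⁿ = IsMultiplier (^-isMultiplier T-isMultiplier n)

UT-oneˡ : ∀ x y F → UT x y one ⊛ F ≋ UT x y F
UT-oneˡ x y F = ≋-trans (⊛ˡ one F) (resp-≋ (⊛-identityˡ F))
  where open IsMultiplier (UT-isMultiplier x y)

UT-oneʳ : ∀ x y F → F ⊛ UT x y one ≋ UT x y F
UT-oneʳ x y F = ≋-trans (⊛ʳ F one) (resp-≋ (⊛-identityʳ F))
  where open IsMultiplier (UT-isMultiplier x y)

lin-⊞ : ∀ α β α′ β′ → lin α β ⊞ lin α′ β′ ≋ lin (α +ᶻ α′) (β +ᶻ β′)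
lin-⊞ α β α′ β′ = pointwise sum
  where
  sum : ∀ i k → lin α β i k +ᶻ lin α′ β′ i k ≡ lin (α +ᶻ α′) (β +ᶻ β′) i k
  sum zero          zero          = refl
  sum zero          (suc zero)    = refl
  sum zero          (suc (suc k)) = refl
  sum (suc zero)    zero          = refl
  sum (suc zero)    (suc k)       = refl
  sum (suc (suc i)) k             = refl

-- The midpoint step

record Profile : Set where
  constructor profile
  field
    x y : ℕ
    α β : ℤ
open Profile public

record Midpoint (c G μ : Profile) : Set where
  field
    x-mid : x c + x G ≡ x μ + x μ
    y-mid : y c + y G ≡ y μ + y μ
    α-mid : α c +ᶻ α G ≡ α μ +ᶻ α μ
    β-mid : β c +ᶻ β G ≡ β μ +ᶻ β μ

record Shape (p : Profile) (F₀ F₁ : Ser₂) : Set where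
  field
    order₀ : T F₀ ≋ UT (x p) (y p) one
    order₁ : (T ^ 3) F₁ ≋ UT (x p) (y p) (lin (α p) (β p))
open Shape public

⊞-solve : ∀ {A E X M C} → (A ⊞ E) ⊞ X ≋ (M ⊞ M) ⊞ E → C ⊞ A ≋ M ⊞ M → X ≋ C
⊞-solve {A} {E} {X} {M} {C} eq mid = pointwise λ i k → begin
  X i k                                        ≡⟨ solve₁ (A i k) (E i k) (X i k) ⟩
  ((A i k +ᶻ E i k) +ᶻ X i k) -ᶻ (A i k +ᶻ E i k) ≡⟨ cong (_-ᶻ (A i k +ᶻ E i k)) (at eq i k) ⟩
  ((M i k +ᶻ M i k) +ᶻ E i k) -ᶻ (A i k +ᶻ E i k) ≡⟨ solve₂ (M i k +ᶻ M i k) (E i k) (A i k) ⟩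
  (M i k +ᶻ M i k) -ᶻ A i k                    ≡⟨ cong (_-ᶻ A i k) (at mid i k) ⟨
  (C i k +ᶻ A i k) -ᶻ A i k                    ≡⟨ solve₃ (C i k) (A i k) ⟩
  C i k                                        ∎
  where
  open ≡-Reasoning
  solve₁ : ∀ a e x → x ≡ ((a +ᶻ e) +ᶻ x) -ᶻ (a +ᶻ e)
  solve₁ = solve-∀
  solve₂ : ∀ m e a → (m +ᶻ e) -ᶻ (a +ᶻ e) ≡ m -ᶻ a
  solve₂ = solve-∀
  solve₃ : ∀ c a → (c +ᶻ a) -ᶻ a ≡ c
  solve₃ = solve-∀

module _ {c G μ : Profile} (mid : Midpoint c G μ) where
  open Midpoint mid

  private
    UTc UTG UTμ UTN : Ser₂ → Ser₂
    UTc = UT (x c) (y c)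
    UTG = UT (x G) (y G)
    UTμ = UT (x μ) (y μ)
    UTN = UT (x c + x G) (y c + y G)

    ℓc ℓG ℓμ : Ser₂
    ℓc = lin (α c) (β c)
    ℓG = lin (α G) (β G)
    ℓμ = lin (α μ) (β μ)

    module UTN = IsMultiplier (UT-isMultiplier (x c + x G) (y c + y G))
    module T² = IsMultiplier (^-isMultiplier T-isMultiplier 2)
    module T⁴ = IsMultiplier (^-isMultiplier T-isMultiplier 4)

    UT-split : ∀ F → UTN F ≋ UTG (UTc F)
    UT-split F = ≋-trans (UT-≡ F (ℕₚ.+-comm (x c) (x G)) (ℕₚ.+-comm (y c) (y G)))
                         (≋-sym (UT-UT (x G) (y G) (x c) (y c) F))

    μ-product : ∀ F F′ → UTμ F ⊛ UTμ F′ ≋ UTN (F ⊛ F′)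
    μ-product F F′ = ≋-trans (UT-⊛ (x μ) (y μ) (x μ) (y μ) F F′) (UT-≡ _ (sym x-mid) (sym y-mid))

    lin-mid : UTN ℓc ⊞ UTN ℓG ≋ UTN ℓμ ⊞ UTN ℓμ
    lin-mid = begin
      UTN ℓc ⊞ UTN ℓG                          ≈⟨ UTN.distrib ℓc ℓG ⟨
      UTN (ℓc ⊞ ℓG)                            ≈⟨ UTN.resp-≋ (lin-⊞ _ _ _ _) ⟩
      UTN (lin (α c +ᶻ α G) (β c +ᶻ β G))      ≡⟨ cong₂ (λ a b → UTN (lin a b)) α-mid β-mid ⟩
      UTN (lin (α μ +ᶻ α μ) (β μ +ᶻ β μ))      ≈⟨ UTN.resp-≋ (lin-⊞ _ _ _ _) ⟨
      UTN (ℓμ ⊞ ℓμ)                            ≈⟨ UTN.distrib ℓμ ℓμ ⟩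
      UTN ℓμ ⊞ UTN ℓμ                          ∎
      where open ≋-Reasoning

  midpoint-order₀ : ∀ {c₀ G₀ μ₀} → T G₀ ≋ UTG one → T μ₀ ≋ UTμ one → c₀ ⊛ G₀ ≋ μ₀ ⊛ μ₀ → T c₀ ≋ UTc one
  midpoint-order₀ {c₀} {G₀} {μ₀} G₀-shape μ₀-shape eq₀ = UT-injective (x G) (y G) (begin
    UTG (T c₀)                ≈⟨ UT-oneʳ (x G) (y G) (T c₀) ⟨
    T c₀ ⊛ UTG one            ≈⟨ ⊛-congˡ (T c₀) G₀-shape ⟨
    T c₀ ⊛ T G₀               ≈⟨ T^-⊛ 1 1 c₀ G₀ ⟨
    (T ^ 2) (c₀ ⊛ G₀)         ≈⟨ T².resp-≋ eq₀ ⟩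
    (T ^ 2) (μ₀ ⊛ μ₀)         ≈⟨ T^-⊛ 1 1 μ₀ μ₀ ⟩
    T μ₀ ⊛ T μ₀               ≈⟨ ⊛-cong μ₀-shape μ₀-shape ⟩
    UTμ one ⊛ UTμ one         ≈⟨ μ-product one one ⟩
    UTN (one ⊛ one)           ≈⟨ UTN.resp-≋ (⊛-identityˡ one) ⟩
    UTN one                   ≈⟨ UT-split one ⟩
    UTG (UTc one)             ∎)
    where open ≋-Reasoning

  -- Multiplying eq₁ by (u + w)⁴ leaves T³ c₁ as the only unknown factor.
  midpoint-order₁ : ∀ {c₀ c₁ G₀ G₁ μ₀ μ₁ E} → T G₀ ≋ UTG one → T c₀ ≋ UTc one → Shape μ μ₀ μ₁ →
    UTc ((T ^ 3) G₁) ≋ UTN ℓG ⊞ (T ^ 4) E →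
    c₀ ⊛ G₁ ⊞ c₁ ⊛ G₀ ≋ (μ₀ ⊛ μ₁ ⊞ μ₁ ⊛ μ₀) ⊞ E →
    (T ^ 3) c₁ ≋ UTc ℓc
  midpoint-order₁ {c₀} {c₁} {G₀} {G₁} {μ₀} {μ₁} {E} G₀-shape c₀-shape μ-shape compensation eq₁ =
    UT-injective (x G) (y G) (≋-trans (⊞-solve {UTN ℓG} {(T ^ 4) E} {UTG ((T ^ 3) c₁)} {UTN ℓμ} {UTN ℓc} multiplied lin-mid)
                                      (UT-split ℓc))
    where
    open ≋-Reasoning
    multiplied : (UTN ℓG ⊞ (T ^ 4) E) ⊞ UTG ((T ^ 3) c₁) ≋ (UTN ℓμ ⊞ UTN ℓμ) ⊞ (T ^ 4) E
    multiplied = begin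
      (UTN ℓG ⊞ (T ^ 4) E) ⊞ UTG ((T ^ 3) c₁)
        ≈⟨ ⊞-cong compensation (UT-oneʳ (x G) (y G) ((T ^ 3) c₁)) ⟨
      UTc ((T ^ 3) G₁) ⊞ (T ^ 3) c₁ ⊛ UTG one
        ≈⟨ ⊞-cong (UT-oneˡ (x c) (y c) ((T ^ 3) G₁)) (⊛-congˡ ((T ^ 3) c₁) G₀-shape) ⟨
      UTc one ⊛ (T ^ 3) G₁ ⊞ (T ^ 3) c₁ ⊛ T G₀
        ≈⟨ ⊞-congʳ ((T ^ 3) c₁ ⊛ T G₀) (⊛-congʳ ((T ^ 3) G₁) c₀-shape) ⟨
      T c₀ ⊛ (T ^ 3) G₁ ⊞ (T ^ 3) c₁ ⊛ T G₀
        ≈⟨ ⊞-cong (T^-⊛ 1 3 c₀ G₁) (T^-⊛ 3 1 c₁ G₀) ⟨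
      (T ^ 4) (c₀ ⊛ G₁) ⊞ (T ^ 4) (c₁ ⊛ G₀)
        ≈⟨ T⁴.distrib _ _ ⟨
      (T ^ 4) (c₀ ⊛ G₁ ⊞ c₁ ⊛ G₀)
        ≈⟨ T⁴.resp-≋ eq₁ ⟩
      (T ^ 4) ((μ₀ ⊛ μ₁ ⊞ μ₁ ⊛ μ₀) ⊞ E)
        ≈⟨ ≋-trans (T⁴.distrib _ E) (⊞-congʳ ((T ^ 4) E) (T⁴.distrib (μ₀ ⊛ μ₁) (μ₁ ⊛ μ₀))) ⟩
      ((T ^ 4) (μ₀ ⊛ μ₁) ⊞ (T ^ 4) (μ₁ ⊛ μ₀)) ⊞ (T ^ 4) E
        ≈⟨ ⊞-congʳ ((T ^ 4) E) (⊞-cong (T^-⊛ 1 3 μ₀ μ₁) (T^-⊛ 3 1 μ₁ μ₀)) ⟩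
      (T μ₀ ⊛ (T ^ 3) μ₁ ⊞ (T ^ 3) μ₁ ⊛ T μ₀) ⊞ (T ^ 4) E
        ≈⟨ ⊞-congʳ ((T ^ 4) E) (⊞-cong (⊛-cong (order₀ μ-shape) (order₁ μ-shape))
                                        (⊛-cong (order₁ μ-shape) (order₀ μ-shape))) ⟩
      (UTμ one ⊛ UTμ ℓμ ⊞ UTμ ℓμ ⊛ UTμ one) ⊞ (T ^ 4) E
        ≈⟨ ⊞-congʳ ((T ^ 4) E) (⊞-cong (≋-trans (μ-product one ℓμ) (UTN.resp-≋ (⊛-identityˡ ℓμ)))
                                        (≋-trans (μ-product ℓμ one) (UTN.resp-≋ (⊛-identityʳ ℓμ)))) ⟩
      (UTN ℓμ ⊞ UTN ℓμ) ⊞ (T ^ 4) E ∎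

  -- eq₀ and eq₁ are the order-0 and order-1 slices of P_c P_G = P_μ² + (terms of order ≥ 1).
  -- The compensation hypothesis says that G has the order-1 shape up to a defect which E
  -- makes up for; in the regular case both vanish.
  midpoint-step : ∀ {c₀ c₁ G₀ G₁ μ₀ μ₁ E} →
    T G₀ ≋ UTG one → Shape μ μ₀ μ₁ →
    UTc ((T ^ 3) G₁) ≋ UTN ℓG ⊞ (T ^ 4) E →
    c₀ ⊛ G₀ ≋ μ₀ ⊛ μ₀ →
    c₀ ⊛ G₁ ⊞ c₁ ⊛ G₀ ≋ (μ₀ ⊛ μ₁ ⊞ μ₁ ⊛ μ₀) ⊞ E →
    Shape c c₀ c₁
  midpoint-step G₀-shape μ-shape compensation eq₀ eq₁ = record
    { order₀ = c₀-shape
    ; order₁ = midpoint-order₁ G₀-shape c₀-shape μ-shape compensation eq₁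
    }
    where c₀-shape = midpoint-order₀ G₀-shape (order₀ μ-shape) eq₀

  midpoint-step-regular : ∀ {c₀ c₁ G₀ G₁ μ₀ μ₁ E} → Shape G G₀ G₁ → Shape μ μ₀ μ₁ → E ≋ 𝟘 →
    c₀ ⊛ G₀ ≋ μ₀ ⊛ μ₀ →
    c₀ ⊛ G₁ ⊞ c₁ ⊛ G₀ ≋ (μ₀ ⊛ μ₁ ⊞ μ₁ ⊛ μ₀) ⊞ E →
    Shape c c₀ c₁
  midpoint-step-regular {G₁ = G₁} {E = E} G-shape μ-shape E≋𝟘 = midpoint-step (order₀ G-shape) μ-shape (begin
    UTc ((T ^ 3) G₁)          ≈⟨ IsMultiplier.resp-≋ (UT-isMultiplier (x c) (y c)) (order₁ G-shape) ⟩
    UTc (UTG ℓG)              ≈⟨ UT-UT (x c) (y c) (x G) (y G) ℓG ⟩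
    UTN ℓG                    ≈⟨ ⊞-identityʳ (UTN ℓG) ⟨
    UTN ℓG ⊞ 𝟘                ≈⟨ ⊞-congˡ (UTN ℓG) (≋-trans (T⁴.resp-≋ E≋𝟘) (multiplier-𝟘 (^-isMultiplier T-isMultiplier 4))) ⟨
    UTN ℓG ⊞ (T ^ 4) E        ∎)
    where open ≋-Reasoning

cube : (T ^ 3) one ≋ UT 1 1 (lin (ℤ.+ 2) (ℤ.+ 1)) ⊞ T (W (W one))
cube = pointwise coefficients
  where
  coefficients : ∀ i k → (T ^ 3) one i k ≡ (UT 1 1 (lin (ℤ.+ 2) (ℤ.+ 1)) ⊞ T (W (W one))) i k
  coefficients zero zero = refl
  coefficients zero (suc zero) = refl
  coefficients zero (suc (suc zero)) = refl
  coefficients zero (suc (suc (suc zero))) = refl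
  coefficients zero (suc (suc (suc (suc _)))) = refl
  coefficients (suc zero) zero = refl
  coefficients (suc zero) (suc zero) = refl
  coefficients (suc zero) (suc (suc zero)) = refl
  coefficients (suc zero) (suc (suc (suc zero))) = refl
  coefficients (suc zero) (suc (suc (suc (suc _)))) = refl
  coefficients (suc (suc zero)) zero = refl
  coefficients (suc (suc zero)) (suc zero) = refl
  coefficients (suc (suc zero)) (suc (suc zero)) = refl
  coefficients (suc (suc zero)) (suc (suc (suc zero))) = refl
  coefficients (suc (suc zero)) (suc (suc (suc (suc _)))) = refl
  coefficients (suc (suc (suc zero))) zero = refl
  coefficients (suc (suc (suc zero))) (suc zero) = refl
  coefficients (suc (suc (suc zero))) (suc (suc zero)) = refl
  coefficients (suc (suc (suc zero))) (suc (suc (suc zero))) = refl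
  coefficients (suc (suc (suc zero))) (suc (suc (suc (suc _)))) = refl
  coefficients (suc (suc (suc (suc _)))) zero = refl
  coefficients (suc (suc (suc (suc _)))) (suc zero) = refl
  coefficients (suc (suc (suc (suc _)))) (suc (suc zero)) = refl
  coefficients (suc (suc (suc (suc _)))) (suc (suc (suc zero))) = refl
  coefficients (suc (suc (suc (suc _)))) (suc (suc (suc (suc _)))) = refl

W-one : W one ≋ lin 1ℤ 0ℤ
W-one = pointwise coefficients
  where
  coefficients : ∀ i k → W one i k ≡ lin 1ℤ 0ℤ i k
  coefficients zero          zero          = refl
  coefficients zero          (suc zero)    = refl
  coefficients zero          (suc (suc k)) = refl
  coefficients (suc zero)    zero          = refl
  coefficients (suc zero)    (suc k)       = refl
  coefficients (suc (suc i)) zero          = refl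
  coefficients (suc (suc i)) (suc k)       = refl

lin-zero : lin 0ℤ 0ℤ ≋ 𝟘
lin-zero = pointwise coefficients
  where
  coefficients : ∀ i k → lin 0ℤ 0ℤ i k ≡ 0ℤ
  coefficients zero          zero          = refl
  coefficients zero          (suc zero)    = refl
  coefficients zero          (suc (suc k)) = refl
  coefficients (suc zero)    zero          = refl
  coefficients (suc zero)    (suc k)       = refl
  coefficients (suc (suc i)) k             = refl

T²-square : ∀ {F x y} → T F ≋ UT x y one → (T ^ 4) (F ⊛ F) ≋ UT (x + x) (suc y + suc y) one
T²-square {F} {x} {y} TF≋ = begin
  (T ^ 4) (F ⊛ F)                       ≈⟨ T^-⊛ 2 2 F F ⟩
  T (T F) ⊛ T (T F)                     ≈⟨ ⊛-cong T²F≋ T²F≋ ⟩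
  UT x (suc y) one ⊛ UT x (suc y) one   ≈⟨ UT-⊛ x (suc y) x (suc y) one one ⟩
  UT (x + x) (suc y + suc y) (one ⊛ one) ≈⟨ IsMultiplier.resp-≋ (UT-isMultiplier (x + x) (suc y + suc y)) (⊛-identityˡ one) ⟩
  UT (x + x) (suc y + suc y) one        ∎
  where
  open ≋-Reasoning
  T²F≋ : T (T F) ≋ UT x (suc y) one
  T²F≋ = ≋-trans (IsMultiplier.resp-≋ T-isMultiplier TF≋) (T^-UT 1 x y one)

-- P_{0/1} has order-1 slice 0, whereas the shape would give (u + w)³ S₁ = −(u + w) w; the
-- extra term makes up the difference.
compensation-0/1 : ∀ {G₁ M₁ R₀ xR yR} xc yc X Y → G₁ ≋ 𝟘 → M₁ ≋ W one → T R₀ ≋ UT xR yR one →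
  X ≡ xR + xR → Y ≡ suc yR + suc yR →
  UT xc yc ((T ^ 3) G₁) ≋ UT X Y (lin (-ᶻ 1ℤ) 0ℤ) ⊞ (T ^ 4) (M₁ ⊛ (R₀ ⊛ R₀))
compensation-0/1 {G₁} {M₁} {R₀} {xR} {yR} xc yc X Y G₁≋𝟘 M₁≋w TR₀≋ refl refl = begin
  UT xc yc ((T ^ 3) G₁)                         ≈⟨ UTc.resp-≋ (≋-trans (T³.resp-≋ G₁≋𝟘) (multiplier-𝟘 T³-isMultiplier)) ⟩
  UT xc yc 𝟘                                    ≈⟨ multiplier-𝟘 (UT-isMultiplier xc yc) ⟩
  𝟘                                             ≈⟨ multiplier-𝟘 (UT-isMultiplier X Y) ⟨
  UT X Y 𝟘                                      ≈⟨ UTN.resp-≋ (≋-trans (lin-⊞ (-ᶻ 1ℤ) 0ℤ 1ℤ 0ℤ) lin-zero) ⟨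
  UT X Y (lin (-ᶻ 1ℤ) 0ℤ ⊞ lin 1ℤ 0ℤ)           ≈⟨ UTN.distrib _ _ ⟩
  UT X Y (lin (-ᶻ 1ℤ) 0ℤ) ⊞ UT X Y (lin 1ℤ 0ℤ)  ≈⟨ ⊞-congˡ (UT X Y (lin (-ᶻ 1ℤ) 0ℤ)) E-term ⟩
  UT X Y (lin (-ᶻ 1ℤ) 0ℤ) ⊞ (T ^ 4) (M₁ ⊛ (R₀ ⊛ R₀)) ∎
  where
  open ≋-Reasoning
  module UTc = IsMultiplier (UT-isMultiplier xc yc)
  module UTN = IsMultiplier (UT-isMultiplier X Y)
  T³-isMultiplier = ^-isMultiplier T-isMultiplier 3
  module T³ = IsMultiplier T³-isMultiplier
  module T⁴ = IsMultiplier (^-isMultiplier T-isMultiplier 4)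
  module W = IsMultiplier W-isMultiplier
  E-term : UT X Y (lin 1ℤ 0ℤ) ≋ (T ^ 4) (M₁ ⊛ (R₀ ⊛ R₀))
  E-term = begin
    UT X Y (lin 1ℤ 0ℤ)              ≈⟨ UTN.resp-≋ W-one ⟨
    UT X Y (W one)                  ≈⟨ multipliers-commute (UT-isMultiplier X Y) W-isMultiplier one ⟩
    W (UT X Y one)                  ≈⟨ W.resp-≋ (T²-square {R₀} {xR} {yR} TR₀≋) ⟨
    W ((T ^ 4) (R₀ ⊛ R₀))           ≈⟨ multipliers-commute (^-isMultiplier T-isMultiplier 4) W-isMultiplier _ ⟨
    (T ^ 4) (W (R₀ ⊛ R₀))           ≈⟨ T⁴.resp-≋ (≋-trans (W-⊛ˡ one (R₀ ⊛ R₀)) (W.resp-≋ (⊛-identityˡ _))) ⟨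
    (T ^ 4) (W one ⊛ (R₀ ⊛ R₀))     ≈⟨ T⁴.resp-≋ (⊛-congʳ (R₀ ⊛ R₀) M₁≋w) ⟨
    (T ^ 4) (M₁ ⊛ (R₀ ⊛ R₀))        ∎

-- P_{1/1} has order-1 slice 1 in v, and (u + w)³ exceeds the predicted u (u + w)(u + 2w)
-- by (u + w) w² (see cube), which the extra term supplies.
compensation-1/1 : ∀ {G₁ M₁ L₀ xL yL} xc yc X Y → G₁ ≋ one → M₁ ≋ U (W (W one)) → T L₀ ≋ UT xL yL one →
  xc ≡ suc (xL + xL) → suc yc ≡ suc yL + suc yL → X ≡ xc + 1 → Y ≡ yc + 1 →
  UT xc yc ((T ^ 3) G₁) ≋ UT X Y (lin (ℤ.+ 2) (ℤ.+ 1)) ⊞ (T ^ 4) (M₁ ⊛ (L₀ ⊛ L₀))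
compensation-1/1 {G₁} {M₁} {L₀} {xL} {yL} xc yc X Y G₁≋one M₁≋uw² TL₀≋ refl 1+yc≡ refl refl = begin
  UT xc yc ((T ^ 3) G₁)                                   ≈⟨ UTc.resp-≋ (≋-trans (T³.resp-≋ G₁≋one) cube) ⟩
  UT xc yc (UT 1 1 ℓ ⊞ T (W (W one)))                     ≈⟨ UTc.distrib _ _ ⟩
  UT xc yc (UT 1 1 ℓ) ⊞ UT xc yc (T (W (W one)))          ≈⟨ ⊞-cong (UT-UT xc yc 1 1 ℓ) E-term ⟩
  UT (xc + 1) (yc + 1) ℓ ⊞ (T ^ 4) (M₁ ⊛ (L₀ ⊛ L₀)) ∎
  where
  open ≋-Reasoning
  ℓ = lin (ℤ.+ 2) (ℤ.+ 1)
  module UTc = IsMultiplier (UT-isMultiplier xc yc)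
  module T³ = IsMultiplier (^-isMultiplier T-isMultiplier 3)
  module T⁴ = IsMultiplier (^-isMultiplier T-isMultiplier 4)
  WW = ∘-isMultiplier W-isMultiplier W-isMultiplier
  UWW = ∘-isMultiplier U-isMultiplier WW
  E-term : UT xc yc (T (W (W one))) ≋ (T ^ 4) (M₁ ⊛ (L₀ ⊛ L₀))
  E-term = begin
    UT xc yc (T (W (W one)))
      ≈⟨ IsMultiplier.resp-≋ (^-isMultiplier U-isMultiplier xc)
           (multipliers-commute (^-isMultiplier T-isMultiplier yc) T-isMultiplier (W (W one))) ⟩
    UT xc (suc yc) (W (W one))
      ≈⟨ UT-≡ {suc (xL + xL)} (W (W one)) refl 1+yc≡ ⟩
    U (UT (xL + xL) (suc yL + suc yL) (W (W one)))
      ≈⟨ IsMultiplier.resp-≋ U-isMultiplier (multipliers-commute (UT-isMultiplier (xL + xL) (suc yL + suc yL)) WW one) ⟩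
    U (W (W (UT (xL + xL) (suc yL + suc yL) one)))
      ≈⟨ IsMultiplier.resp-≋ UWW (T²-square {L₀} {xL} {yL} TL₀≋) ⟨
    U (W (W ((T ^ 4) (L₀ ⊛ L₀))))
      ≈⟨ multipliers-commute (^-isMultiplier T-isMultiplier 4) UWW _ ⟨
    (T ^ 4) (U (W (W (L₀ ⊛ L₀))))
      ≈⟨ T⁴.resp-≋ (≋-trans (IsMultiplier.⊛ˡ UWW one (L₀ ⊛ L₀)) (IsMultiplier.resp-≋ UWW (⊛-identityˡ _))) ⟨
    (T ^ 4) (U (W (W one)) ⊛ (L₀ ⊛ L₀))
      ≈⟨ T⁴.resp-≋ (⊛-congʳ (L₀ ⊛ L₀) M₁≋uw²) ⟨
    (T ^ 4) (M₁ ⊛ (L₀ ⊛ L₀))                  ∎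

-- Slices of series in three variables

δ : ℕ → ℕ → ℤ
δ zero    zero    = 1ℤ
δ zero    (suc n) = 0ℤ
δ (suc m) zero    = 0ℤ
δ (suc m) (suc n) = δ m n

δ-refl : ∀ n → δ n n ≡ 1ℤ
δ-refl zero    = refl
δ-refl (suc n) = δ-refl n

δ-≢ : ∀ {m n} → ¬ m ≡ n → δ m n ≡ 0ℤ
δ-≢ {zero}  {zero}  m≢n = contradiction refl m≢n
δ-≢ {zero}  {suc n} m≢n = refl
δ-≢ {suc m} {zero}  m≢n = refl
δ-≢ {suc m} {suc n} m≢n = δ-≢ (m≢n ∘ cong suc)

mono-δ : ∀ r s t i j k → mono r s t i j k ≡ δ i r *ᶻ (δ j s *ᶻ δ k t)
mono-δ r s t i j k with i ≟ r | j ≟ s | k ≟ t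
... | yes refl | yes refl | yes refl = sym (cong₂ _*ᶻ_ (δ-refl i) (cong₂ _*ᶻ_ (δ-refl j) (δ-refl k)))
... | no i≢r   | _        | _        = sym (cong (_*ᶻ _) (δ-≢ i≢r))
... | yes _    | no j≢s   | _        = sym (trans (cong (λ d → δ i r *ᶻ (d *ᶻ δ k t)) (δ-≢ j≢s)) (ℤₚ.*-zeroʳ (δ i r)))
... | yes _    | yes _    | no k≢t   = sym (trans (cong (λ d → δ i r *ᶻ (δ j s *ᶻ d)) (δ-≢ k≢t))
                                                 (trans (cong (δ i r *ᶻ_) (ℤₚ.*-zeroʳ (δ j s))) (ℤₚ.*-zeroʳ (δ i r))))

monomial : ℕ → ℕ → Ser₂
monomial r t = (U ^ r) ((W ^ t) one)

monomial-δ : ∀ r t i k → monomial r t i k ≡ δ i r *ᶻ δ k t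
monomial-δ (suc r) t zero    k = refl
monomial-δ (suc r) t (suc i) k = monomial-δ r t i k
monomial-δ zero (suc t) i zero    = sym (ℤₚ.*-zeroʳ (δ i 0))
monomial-δ zero (suc t) i (suc k) = monomial-δ zero t i k
monomial-δ zero zero zero    zero    = refl
monomial-δ zero zero zero    (suc k) = refl
monomial-δ zero zero (suc i) k       = refl

record Slicing : Set where
  field
    slice₀ slice₁ : Ser → Ser₂
    slice₀-≈ : ∀ {f g} → f ≈ g → slice₀ f ≋ slice₀ g
    slice₁-≈ : ∀ {f g} → f ≈ g → slice₁ f ≋ slice₁ g
    slice₀-⊕ : ∀ f g → slice₀ (f ⊕ g) ≋ slice₀ f ⊞ slice₀ g
    slice₁-⊕ : ∀ f g → slice₁ (f ⊕ g) ≋ slice₁ f ⊞ slice₁ g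
    slice₀-⊗ : ∀ f g → slice₀ (f ⊗ g) ≋ slice₀ f ⊛ slice₀ g
    slice₁-⊗ : ∀ f g → slice₁ (f ⊗ g) ≋ slice₀ f ⊛ slice₁ g ⊞ slice₁ f ⊛ slice₀ g

v-slice w-slice : ℕ → Ser → Ser₂
v-slice n f i k = f i n k
w-slice n f i j = f i j n

v-slicing : Slicing
v-slicing = record
  { slice₀   = v-slice 0
  ; slice₁   = v-slice 1
  ; slice₀-≈ = λ f≈g → pointwise λ i k → f≈g i 0 k
  ; slice₁-≈ = λ f≈g → pointwise λ i k → f≈g i 1 k
  ; slice₀-⊕ = λ f g → ≋-refl
  ; slice₁-⊕ = λ f g → ≋-refl
  ; slice₀-⊗ = λ f g → ≋-refl
  ; slice₁-⊗ = λ f g → pointwise λ i k → sumTo-+ i _ _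
  }

w-slicing : Slicing
w-slicing = record
  { slice₀   = w-slice 0
  ; slice₁   = w-slice 1
  ; slice₀-≈ = λ f≈g → pointwise λ i j → f≈g i j 0
  ; slice₁-≈ = λ f≈g → pointwise λ i j → f≈g i j 1
  ; slice₀-⊕ = λ f g → ≋-refl
  ; slice₁-⊕ = λ f g → ≋-refl
  ; slice₀-⊗ = λ f g → ≋-refl
  ; slice₁-⊗ = λ f g → pointwise λ i j → trans (sumTo-cong i λ t _ → sumTo-+ j _ _) (sumTo-+ i _ _)
  }

v-slice-mono : ∀ r s t → v-slice s (mono r s t) ≋ monomial r t
v-slice-mono r s t = pointwise λ i k → begin
  mono r s t i s k               ≡⟨ mono-δ r s t i s k ⟩
  δ i r *ᶻ (δ s s *ᶻ δ k t)      ≡⟨ cong (λ d → δ i r *ᶻ (d *ᶻ δ k t)) (δ-refl s) ⟩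
  δ i r *ᶻ (1ℤ *ᶻ δ k t)         ≡⟨ cong (δ i r *ᶻ_) (ℤₚ.*-identityˡ (δ k t)) ⟩
  δ i r *ᶻ δ k t                 ≡⟨ monomial-δ r t i k ⟨
  monomial r t i k               ∎
  where open ≡-Reasoning

v-slice-mono-≢ : ∀ {n s} r t → ¬ n ≡ s → v-slice n (mono r s t) ≋ 𝟘
v-slice-mono-≢ {n} {s} r t n≢s = pointwise λ i k → begin
  mono r s t i n k               ≡⟨ mono-δ r s t i n k ⟩
  δ i r *ᶻ (δ n s *ᶻ δ k t)      ≡⟨ cong (λ d → δ i r *ᶻ (d *ᶻ δ k t)) (δ-≢ n≢s) ⟩
  δ i r *ᶻ 0ℤ                    ≡⟨ ℤₚ.*-zeroʳ (δ i r) ⟩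
  0ℤ                             ∎
  where open ≡-Reasoning

w-slice-mono : ∀ r s t → w-slice t (mono r s t) ≋ monomial r s
w-slice-mono r s t = pointwise λ i j → begin
  mono r s t i j t               ≡⟨ mono-δ r s t i j t ⟩
  δ i r *ᶻ (δ j s *ᶻ δ t t)      ≡⟨ cong (λ d → δ i r *ᶻ (δ j s *ᶻ d)) (δ-refl t) ⟩
  δ i r *ᶻ (δ j s *ᶻ 1ℤ)         ≡⟨ cong (δ i r *ᶻ_) (ℤₚ.*-identityʳ (δ j s)) ⟩
  δ i r *ᶻ δ j s                 ≡⟨ monomial-δ r s i j ⟨
  monomial r s i j               ∎
  where open ≡-Reasoning

w-slice-mono-≢ : ∀ {n t} r s → ¬ n ≡ t → w-slice n (mono r s t) ≋ 𝟘
w-slice-mono-≢ {n} {t} r s n≢t = pointwise λ i j → begin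
  mono r s t i j n               ≡⟨ mono-δ r s t i j n ⟩
  δ i r *ᶻ (δ j s *ᶻ δ n t)      ≡⟨ cong (λ d → δ i r *ᶻ (δ j s *ᶻ d)) (δ-≢ n≢t) ⟩
  δ i r *ᶻ (δ j s *ᶻ 0ℤ)         ≡⟨ cong (δ i r *ᶻ_) (ℤₚ.*-zeroʳ (δ j s)) ⟩
  δ i r *ᶻ 0ℤ                    ≡⟨ ℤₚ.*-zeroʳ (δ i r) ⟩
  0ℤ                             ∎
  where open ≡-Reasoning

module Jets (S : Slicing) where
  open Slicing S

  record Jet (f : Ser) (F₀ F₁ : Ser₂) : Set where
    constructor jet
    field
      jet₀ : slice₀ f ≋ F₀
      jet₁ : slice₁ f ≋ F₁

  slices : ∀ f → Jet f (slice₀ f) (slice₁ f)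
  slices f = jet ≋-refl ≋-refl

  jet-≈ : ∀ {f g F₀ F₁} → f ≈ g → Jet g F₀ F₁ → Jet f F₀ F₁
  jet-≈ f≈g (jet g₀ g₁) = jet (≋-trans (slice₀-≈ f≈g) g₀) (≋-trans (slice₁-≈ f≈g) g₁)

  jet-⊕ : ∀ {f g F₀ F₁ G₀ G₁} → Jet f F₀ F₁ → Jet g G₀ G₁ → Jet (f ⊕ g) (F₀ ⊞ G₀) (F₁ ⊞ G₁)
  jet-⊕ {f} {g} (jet f₀ f₁) (jet g₀ g₁) =
    jet (≋-trans (slice₀-⊕ f g) (⊞-cong f₀ g₀)) (≋-trans (slice₁-⊕ f g) (⊞-cong f₁ g₁))

  jet-⊗ : ∀ {f g F₀ F₁ G₀ G₁} → Jet f F₀ F₁ → Jet g G₀ G₁ → Jet (f ⊗ g) (F₀ ⊛ G₀) (F₀ ⊛ G₁ ⊞ F₁ ⊛ G₀)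
  jet-⊗ {f} {g} (jet f₀ f₁) (jet g₀ g₁) =
    jet (≋-trans (slice₀-⊗ f g) (⊛-cong f₀ g₀)) (≋-trans (slice₁-⊗ f g) (⊞-cong (⊛-cong f₀ g₁) (⊛-cong f₁ g₀)))

  jet-unique : ∀ {f F₀ F₁ G₀ G₁} → Jet f F₀ F₁ → Jet f G₀ G₁ → F₀ ≋ G₀ × F₁ ≋ G₁
  jet-unique (jet f₀ f₁) (jet g₀ g₁) = ≋-trans (≋-sym f₀) g₀ , ≋-trans (≋-sym f₁) g₁

  jet-resp : ∀ {f F₀ F₁ G₀ G₁} → F₀ ≋ G₀ → F₁ ≋ G₁ → Jet f F₀ F₁ → Jet f G₀ G₁
  jet-resp F₀≋G₀ F₁≋G₁ (jet f₀ f₁) = jet (≋-trans f₀ F₀≋G₀) (≋-trans f₁ F₁≋G₁)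

  jet-⊗-unitʳ : ∀ {f g F₀ F₁} → Jet f F₀ F₁ → Jet g one 𝟘 → Jet (f ⊗ g) F₀ F₁
  jet-⊗-unitʳ {F₀ = F₀} {F₁} jf jg = jet-resp (⊛-identityʳ F₀)
    (≋-trans (⊞-cong (⊛-zeroʳ F₀) (⊛-identityʳ F₁)) (⊞-identityˡ F₁)) (jet-⊗ jf jg)

  sliced-relation : ∀ {Pc PG M PL Pμ} →
    Pc ⊗ PG ≈ M ⊗ (PL ⊗ PL) ⊕ Pμ ⊗ Pμ → slice₀ M ≋ 𝟘 →
    slice₀ Pc ⊛ slice₀ PG ≋ slice₀ Pμ ⊛ slice₀ Pμ ×
    slice₀ Pc ⊛ slice₁ PG ⊞ slice₁ Pc ⊛ slice₀ PG ≋
      (slice₀ Pμ ⊛ slice₁ Pμ ⊞ slice₁ Pμ ⊛ slice₀ Pμ) ⊞ slice₁ M ⊛ (slice₀ PL ⊛ slice₀ PL)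
  sliced-relation {Pc} {PG} {M} {PL} {Pμ} rel M₀≋𝟘 =
    ≋-trans product₀ (≋-trans (⊞-congʳ (μ₀ ⊛ μ₀) (⊛-zeroˡ (L₀ ⊛ L₀))) (⊞-identityˡ (μ₀ ⊛ μ₀))) ,
    ≋-trans product₁ (≋-trans (⊞-congʳ μ-term (≋-trans (⊞-congʳ M-term (⊛-zeroˡ (L₀ ⊛ slice₁ PL ⊞ slice₁ PL ⊛ L₀)))
                                                       (⊞-identityˡ M-term)))
                              (⊞-comm M-term μ-term))
    where
    L₀ = slice₀ PL
    μ₀ = slice₀ Pμ
    μ-term = slice₀ Pμ ⊛ slice₁ Pμ ⊞ slice₁ Pμ ⊛ slice₀ Pμ
    M-term = slice₁ M ⊛ (L₀ ⊛ L₀)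
    equal-jets = jet-unique (jet-⊗ (slices Pc) (slices PG))
      (jet-≈ rel (jet-⊕ (jet-⊗ (jet M₀≋𝟘 ≋-refl) (jet-⊗ (slices PL) (slices PL))) (jet-⊗ (slices Pμ) (slices Pμ))))
    product₀ = proj₁ equal-jets
    product₁ = proj₂ equal-jets

-- The Stern–Brocot tree

data Descendant (p₀ q₀ r₀ s₀ : ℕ) : ℕ → ℕ → ℕ → ℕ → Set where
  root  : Descendant p₀ q₀ r₀ s₀ p₀ q₀ r₀ s₀
  left  : ∀ {p q r s} → Descendant p₀ q₀ r₀ s₀ p q r s → Descendant p₀ q₀ r₀ s₀ p q (p + r) (q + s)
  right : ∀ {p q r s} → Descendant p₀ q₀ r₀ s₀ p q r s → Descendant p₀ q₀ r₀ s₀ (p + r) (q + s) r s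

descendant-trans : ∀ {p₀ q₀ r₀ s₀ p₁ q₁ r₁ s₁ p q r s} →
  Descendant p₀ q₀ r₀ s₀ p₁ q₁ r₁ s₁ → Descendant p₁ q₁ r₁ s₁ p q r s → Descendant p₀ q₀ r₀ s₀ p q r s
descendant-trans d root      = d
descendant-trans d (left e)  = left (descendant-trans d e)
descendant-trans d (right e) = right (descendant-trans d e)

descendant-det : ∀ {p₀ q₀ r₀ s₀ p q r s} → Descendant p₀ q₀ r₀ s₀ p q r s →
  q₀ * r₀ ≡ p₀ * s₀ + 1 → q * r ≡ p * s + 1
descendant-det root      det₀ = det₀
descendant-det (left {p} {q} {r} {s} d) det₀ = begin
  q * (p + r)         ≡⟨ ℕₚ.*-distribˡ-+ q p r ⟩
  q * p + q * r       ≡⟨ cong (q * p +_) (descendant-det d det₀) ⟩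
  q * p + (p * s + 1) ≡⟨ rearrange p q s ⟩
  p * (q + s) + 1     ∎
  where
  open ≡-Reasoning
  rearrange : ∀ p q s → q * p + (p * s + 1) ≡ p * (q + s) + 1
  rearrange = ℕ-Solver.solve-∀
descendant-det (right {p} {q} {r} {s} d) det₀ = begin
  (q + s) * r         ≡⟨ ℕₚ.*-distribʳ-+ r q s ⟩
  q * r + s * r       ≡⟨ cong (_+ s * r) (descendant-det d det₀) ⟩
  (p * s + 1) + s * r ≡⟨ rearrange p r s ⟩
  (p + r) * s + 1     ∎
  where
  open ≡-Reasoning
  rearrange : ∀ p r s → (p * s + 1) + s * r ≡ (p + r) * s + 1
  rearrange = ℕ-Solver.solve-∀

det⇒numerator-pos : ∀ {p q r s} → q * r ≡ p * s + 1 → 1 ≤ r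
det⇒numerator-pos {p} {q} {zero}  {s} det = contradiction (trans (sym (ℕₚ.*-zeroʳ q)) (trans det (ℕₚ.+-comm (p * s) 1))) λ ()
det⇒numerator-pos {r = suc r} det = s≤s z≤n

descendant-below-one : ∀ {p q r s} → Descendant 0 1 1 1 p q r s → p < q × r ≤ s
descendant-below-one root = s≤s z≤n , s≤s z≤n
descendant-below-one (left d) with p<q , r≤s ← descendant-below-one d =
  p<q , ℕₚ.+-mono-≤ (ℕₚ.<⇒≤ p<q) r≤s
descendant-below-one (right d) with p<q , r≤s ← descendant-below-one d =
  ℕₚ.+-mono-<-≤ p<q r≤s , r≤s

left-end : ∀ {p q r s} → Descendant 0 1 1 1 p q r s → q < 2 → p ≡ 0 × q ≡ 1 × r ≡ 1
left-end {p} {q} d (s≤s q≤1) with p<q , _ ← descendant-below-one d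
  with ℕₚ.n≤0⇒n≡0 (ℕₚ.≤-pred (ℕₚ.≤-trans p<q q≤1)) | ℕₚ.≤-antisym q≤1 (ℕₚ.≤-trans (s≤s z≤n) p<q)
... | refl | refl = refl , refl , trans (sym (ℕₚ.*-identityˡ _)) (descendant-det d refl)

right-end : ∀ {p q r s} → Descendant 0 1 1 1 p q r s → s < 2 → r ≡ 1 × s ≡ 1 × q ≡ p + 1
right-end {p} {q} {r} {s} d (s≤s s≤1) with _ , r≤s ← descendant-below-one d
  with 1≤r ← det⇒numerator-pos {p} {q} {r} {s} (descendant-det d refl)
  with ℕₚ.≤-antisym (ℕₚ.≤-trans r≤s s≤1) 1≤r | ℕₚ.≤-antisym s≤1 (ℕₚ.≤-trans 1≤r r≤s)
... | refl | refl = refl , refl , trans (sym (ℕₚ.*-identityʳ q)) (trans (descendant-det d refl) (cong (_+ 1) (ℕₚ.*-identityʳ p)))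

-- Images under the maps x ↦ x / (1 + x) and x ↦ 1 + x of the Stern–Brocot tree.
descendant-x/1+x : ∀ {p q r s} → Descendant 0 1 1 0 p q r s → Descendant 0 1 1 1 p (p + q) r (r + s)
descendant-x/1+x root = root
descendant-x/1+x (left {p} {q} {r} {s} d) =
  subst (Descendant 0 1 1 1 p (p + q) (p + r)) (+-interchange p q r s) (left (descendant-x/1+x d))
descendant-x/1+x (right {p} {q} {r} {s} d) =
  subst (λ m → Descendant 0 1 1 1 (p + r) m r (r + s)) (+-interchange p q r s) (right (descendant-x/1+x d))

descendant-1+x : ∀ {p q r s} → Descendant 0 1 1 0 p q r s → Descendant 0 1 1 0 (p + q) q (r + s) s
descendant-1+x root = right root
descendant-1+x (left {p} {q} {r} {s} d) =
  subst (λ m → Descendant 0 1 1 0 (p + q) q m (q + s)) (+-interchange p q r s) (left (descendant-1+x d))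
descendant-1+x (right {p} {q} {r} {s} d) =
  subst (λ m → Descendant 0 1 1 0 m (q + s) (r + s) s) (+-interchange p q r s) (right (descendant-1+x d))

record MediantOf (p₀ q₀ r₀ s₀ a b : ℕ) : Set where
  constructor mediant
  field
    {p q r s}   : ℕ
    descendant  : Descendant p₀ q₀ r₀ s₀ p q r s
    numerator   : p + r ≡ a
    denominator : q + s ≡ b

coprime-∸ : ∀ {a b} → a ≤ b → Coprime a b → Coprime a (b ∸ a)
coprime-∸ a≤b a⊥b (d∣a , d∣b∸a) = a⊥b (d∣a , subst (_ ∣_) (ℕₚ.m+[n∸m]≡n a≤b) (∣m∣n⇒∣m+n d∣a d∣b∸a))

mediant-x/1+x : ∀ {a c} → MediantOf 0 1 1 0 a c → MediantOf 0 1 1 1 a (a + c)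
mediant-x/1+x {a} {c} (mediant {p} {q} {r} {s} d p+r≡a q+s≡c) =
  mediant (descendant-x/1+x d) p+r≡a (trans (+-interchange p q r s) (cong₂ _+_ p+r≡a q+s≡c))

mediant-1+x : ∀ {c b} → MediantOf 0 1 1 0 c b → MediantOf 0 1 1 0 (b + c) b
mediant-1+x {c} {b} (mediant {p} {q} {r} {s} d p+r≡c q+s≡b) =
  mediant (descendant-1+x d) (trans (+-interchange p q r s) (trans (ℕₚ.+-comm (p + r) (q + s)) (cong₂ _+_ q+s≡b p+r≡c))) q+s≡b

mediant-below-one : ∀ {a b} → MediantOf 0 1 1 1 a b → MediantOf 0 1 1 0 a b
mediant-below-one (mediant d p+r≡a q+s≡b) = mediant (descendant-trans (left root) d) p+r≡a q+s≡b

coprime-mediant : ∀ {a b} → Coprime a b → 1 ≤ a → 1 ≤ b → MediantOf 0 1 1 0 a b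
coprime-mediant {a} {b} = euclid (a + b) ℕₚ.≤-refl
  where
  euclid : ∀ n {a b} → a + b ≤ n → Coprime a b → 1 ≤ a → 1 ≤ b → MediantOf 0 1 1 0 a b
  euclid zero {suc a} () _ _ _
  euclid (suc n) {a} {b} a+b≤1+n a⊥b 1≤a 1≤b with ℕₚ.<-cmp a b
  ... | tri≈ _ refl _ = mediant root (sym a≡1) (sym a≡1)
    where a≡1 = a⊥b (∣-refl , ∣-refl)
  ... | tri< a<b _ _ = subst (MediantOf 0 1 1 0 a) b-a+a≡b (mediant-below-one (mediant-x/1+x smaller))
    where
    b-a+a≡b = ℕₚ.m+[n∸m]≡n (ℕₚ.<⇒≤ a<b)
    smaller = euclid n (subst (_≤ n) (sym b-a+a≡b)
                              (ℕₚ.≤-pred (ℕₚ.≤-trans (ℕₚ.m<n+m b 1≤a) a+b≤1+n)))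
                       (coprime-∸ (ℕₚ.<⇒≤ a<b) a⊥b) 1≤a (ℕₚ.m<n⇒0<n∸m a<b)
  ... | tri> _ _ b<a = subst (λ a → MediantOf 0 1 1 0 a b) b+a-b≡a (mediant-1+x smaller)
    where
    b+a-b≡a = ℕₚ.m+[n∸m]≡n (ℕₚ.<⇒≤ b<a)
    smaller = euclid n (subst (_≤ n) (sym (ℕₚ.m∸n+n≡m (ℕₚ.<⇒≤ b<a)))
                              (ℕₚ.≤-pred (ℕₚ.≤-trans (ℕₚ.m<m+n a 1≤b) a+b≤1+n)))
                       (Coprime.sym (coprime-∸ (ℕₚ.<⇒≤ b<a) (Coprime.sym a⊥b))) (ℕₚ.m<n⇒0<n∸m b<a) 1≤b

coprime-mediant-below-one : ∀ {a b} → Coprime a b → 1 ≤ a → a < b → MediantOf 0 1 1 1 a b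
coprime-mediant-below-one {a} {b} a⊥b 1≤a a<b =
  subst (MediantOf 0 1 1 1 a) (ℕₚ.m+[n∸m]≡n (ℕₚ.<⇒≤ a<b))
        (mediant-x/1+x (coprime-mediant (coprime-∸ (ℕₚ.<⇒≤ a<b) a⊥b) 1≤a (ℕₚ.m<n⇒0<n∸m a<b)))

-- Pascal transforms and log-concavity

prev : (ℕ → ℕ) → ℕ → ℕ
prev x zero    = 0
prev x (suc j) = x j

pascal : (ℕ → ℕ) → ℕ → ℕ
pascal x j = prev x j + x j

pascalⁿ : ℕ → (ℕ → ℕ) → ℕ → ℕ
pascalⁿ zero    x = x
pascalⁿ (suc m) x = pascal (pascalⁿ m x)

two-terms : ℕ → ℕ → ℕ → ℕ
two-terms α β zero          = α
two-terms α β (suc zero)    = β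
two-terms α β (suc (suc j)) = 0

pascal-vanishes : ∀ {n x} → (∀ {j} → n < j → x j ≡ 0) → ∀ {j} → suc n < j → pascal x j ≡ 0
pascal-vanishes x-vanishes {suc j} (s≤s n<j) = cong₂ _+_ (x-vanishes n<j) (x-vanishes (ℕₚ.m<n⇒m<1+n n<j))

pascalⁿ-vanishes : ∀ {n x} → (∀ {j} → n < j → x j ≡ 0) → ∀ m {j} → m + n < j → pascalⁿ m x j ≡ 0
pascalⁿ-vanishes x-vanishes zero    = x-vanishes
pascalⁿ-vanishes x-vanishes (suc m) = pascal-vanishes (pascalⁿ-vanishes x-vanishes m)

record LogConcaveOn (n : ℕ) (x : ℕ → ℕ) : Set where
  field
    vanishes          : ∀ {j} → n < j → x j ≡ 0
    positive          : ∀ {j} → j ≤ n → 0 < x j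
    concave           : ∀ j → x j * x (2 + j) ≤ x (1 + j) * x (1 + j)
    strictly-concave  : ∀ {j} → 2 + j ≤ n → x j * x (2 + j) < x (1 + j) * x (1 + j)

expand-product : ∀ a b c d → (a + b) * (c + d) ≡ a * c + a * d + b * c + b * d
expand-product = ℕ-Solver.solve-∀

expand-square : ∀ b c → (b + c) * (b + c) ≡ b * b + b * c + b * c + c * c
expand-square = ℕ-Solver.solve-∀

-- Compare (a + b)(c + d) = ac + ad + bc + bd with (b + c)² = bb + bc + bc + cc termwise.
pascal-concave : ∀ {a b c d} → a * c ≤ b * b → a * d ≤ b * c → b * d ≤ c * c →
  (a + b) * (c + d) ≤ (b + c) * (b + c)
pascal-concave {a} {b} {c} {d} ac≤bb ad≤bc bd≤cc =
  subst₂ _≤_ (sym (expand-product a b c d)) (sym (expand-square b c))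
    (ℕₚ.+-mono-≤ (ℕₚ.+-mono-≤ (ℕₚ.+-mono-≤ ac≤bb ad≤bc) ℕₚ.≤-refl) bd≤cc)

pascal-strictly-concave : ∀ {a b c d} → a * c < b * b → a * d ≤ b * c → b * d ≤ c * c →
  (a + b) * (c + d) < (b + c) * (b + c)
pascal-strictly-concave {a} {b} {c} {d} ac<bb ad≤bc bd≤cc =
  subst₂ _<_ (sym (expand-product a b c d)) (sym (expand-square b c))
    (ℕₚ.+-mono-<-≤ (ℕₚ.+-mono-<-≤ (ℕₚ.+-mono-<-≤ ac<bb ad≤bc) ℕₚ.≤-refl) bd≤cc)

-- Multiply the two inequalities and cancel b c > 0.
concave-cross : ∀ {a b c d} → a * c ≤ b * b → b * d ≤ c * c → 0 < b → 0 < c → a * d ≤ b * c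
concave-cross {a} {b} {c} {d} ac≤bb bd≤cc 0<b 0<c =
  ℕₚ.*-cancelʳ-≤ (a * d) (b * c) (b * c) {{>-nonZero (ℕₚ.*-mono-≤ 0<b 0<c)}}
    (subst₂ _≤_ (regroupₗ a b c d) (regroupᵣ b c) (ℕₚ.*-mono-≤ ac≤bb bd≤cc))
  where
  regroupₗ : ∀ a b c d → a * c * (b * d) ≡ a * d * (b * c)
  regroupₗ = ℕ-Solver.solve-∀
  regroupᵣ : ∀ b c → b * b * (c * c) ≡ b * c * (b * c)
  regroupᵣ = ℕ-Solver.solve-∀

pascal-logConcave : ∀ {n x} → LogConcaveOn n x → LogConcaveOn (suc n) (pascal x)
pascal-logConcave {n} {x} lc = record
  { vanishes         = pascal-vanishes vanishes
  ; positive         = positive′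
  ; concave          = λ j → pascal-concave {prev x j} {x j} {x (1 + j)} {x (2 + j)} (prev-concave j) (cross j) (concave j)
  ; strictly-concave = λ {j} 2+j≤1+n → pascal-strictly-concave {prev x j} {x j} {x (1 + j)} {x (2 + j)}
                                          (prev-strictly-concave (ℕₚ.≤-pred 2+j≤1+n)) (cross j) (concave j)
  }
  where
  open LogConcaveOn lc

  positive′ : ∀ {j} → j ≤ suc n → 0 < pascal x j
  positive′ {zero}  _         = positive z≤n
  positive′ {suc j} (s≤s j≤n) = ℕₚ.<-≤-trans (positive j≤n) (ℕₚ.m≤m+n (x j) (x (suc j)))

  prev-concave : ∀ j → prev x j * x (1 + j) ≤ x j * x j
  prev-concave zero    = z≤n
  prev-concave (suc j) = concave j

  prev-strictly-concave : ∀ {j} → 1 + j ≤ n → prev x j * x (1 + j) < x j * x j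
  prev-strictly-concave {zero}  1≤n         = ℕₚ.*-mono-< (positive z≤n) (positive z≤n)
  prev-strictly-concave {suc j} 2+j≤n       = strictly-concave 2+j≤n

  cross : ∀ j → prev x j * x (2 + j) ≤ x j * x (1 + j)
  cross j with j <? n
  ... | yes j<n = concave-cross {prev x j} (prev-concave j) (concave j) (positive (ℕₚ.<⇒≤ j<n)) (positive j<n)
  ... | no  j≮n = ℕₚ.≤-trans (ℕₚ.≤-reflexive (trans (cong (prev x j *_) (vanishes n<2+j)) (ℕₚ.*-zeroʳ (prev x j)))) z≤n
    where n<2+j = s≤s (ℕₚ.m≤n⇒m≤1+n (ℕₚ.≮⇒≥ j≮n))

pascalⁿ-logConcave : ∀ {n x} → LogConcaveOn n x → ∀ m → LogConcaveOn (m + n) (pascalⁿ m x)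
pascalⁿ-logConcave lc zero    = lc
pascalⁿ-logConcave lc (suc m) = pascal-logConcave (pascalⁿ-logConcave lc m)

two-terms-concave : ∀ α β j → two-terms α β j * two-terms α β (2 + j) ≤ two-terms α β (1 + j) * two-terms α β (1 + j)
two-terms-concave α β j = ℕₚ.≤-trans (ℕₚ.≤-reflexive (ℕₚ.*-zeroʳ (two-terms α β j))) z≤n

two-terms-logConcave : ∀ {α β} → 0 < α → 0 < β → LogConcaveOn 1 (two-terms α β)
two-terms-logConcave 0<α 0<β = record
  { vanishes         = λ { {suc (suc j)} _ → refl ; {suc zero} (s≤s ()) }
  ; positive         = λ { {zero} _ → 0<α ; {suc zero} _ → 0<β ; {suc (suc j)} (s≤s ()) }
  ; concave          = two-terms-concave _ _
  ; strictly-concave = λ { (s≤s ()) }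
  }

single-term-logConcave : ∀ {α} → 0 < α → LogConcaveOn 0 (two-terms α 0)
single-term-logConcave 0<α = record
  { vanishes         = λ { {suc zero} _ → refl ; {suc (suc j)} _ → refl }
  ; positive         = λ { {zero} _ → 0<α ; {suc j} () }
  ; concave          = two-terms-concave _ _
  ; strictly-concave = λ ()
  }

T-antidiagonal : ∀ {F d x} → (∀ j k → j + k ≡ d → F j k ≡ ℤ.+ x j) → (∀ {j} → d < j → x j ≡ 0) →
  ∀ j k → j + k ≡ suc d → T F j k ≡ ℤ.+ pascal x j
T-antidiagonal F≗x x-vanishes zero    (suc k) j+k≡1+d = trans (ℤₚ.+-identityˡ _) (F≗x 0 k (ℕₚ.suc-injective j+k≡1+d))
T-antidiagonal {F} {d} {x} F≗x x-vanishes (suc j) zero j+k≡1+d = begin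
  F j 0 +ᶻ 0ℤ                   ≡⟨ ℤₚ.+-identityʳ (F j 0) ⟩
  F j 0                         ≡⟨ F≗x j 0 j+0≡d ⟩
  ℤ.+ x j                       ≡⟨ cong ℤ.+_ (ℕₚ.+-identityʳ (x j)) ⟨
  ℤ.+ (x j + 0)                 ≡⟨ cong (λ n → ℤ.+ (x j + n)) (x-vanishes d<1+j) ⟨
  ℤ.+ (x j + x (suc j))         ∎
  where
  open ≡-Reasoning
  j+0≡d = ℕₚ.suc-injective j+k≡1+d
  d<1+j = s≤s (ℕₚ.≤-reflexive (trans (sym j+0≡d) (ℕₚ.+-identityʳ j)))
T-antidiagonal {x = x} F≗x x-vanishes (suc j) (suc k) j+k≡1+d =
  trans (cong₂ _+ᶻ_ (F≗x j (suc k) (ℕₚ.suc-injective j+k≡1+d))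
                    (F≗x (suc j) k (trans (sym (ℕₚ.+-suc j k)) (ℕₚ.suc-injective j+k≡1+d))))
        (sym (ℤₚ.pos-+ (x j) (x (suc j))))

T^-antidiagonal : ∀ {F d x} → (∀ j k → j + k ≡ d → F j k ≡ ℤ.+ x j) → (∀ {j} → d < j → x j ≡ 0) →
  ∀ m j k → j + k ≡ m + d → (T ^ m) F j k ≡ ℤ.+ pascalⁿ m x j
T^-antidiagonal F≗x x-vanishes zero    = F≗x
T^-antidiagonal F≗x x-vanishes (suc m) =
  T-antidiagonal (T^-antidiagonal F≗x x-vanishes m) (pascalⁿ-vanishes x-vanishes m)

applyUpTo-strictlyLogConcave : ∀ L (g : ℕ → ℤ) →
  (∀ j → 2 + j < L → g j ℤ.* g (2 + j) ℤ.< g (1 + j) ℤ.* g (1 + j)) →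
  StrictlyLogConcave (applyUpTo g L)
applyUpTo-strictlyLogConcave zero                g _   = tt
applyUpTo-strictlyLogConcave (suc zero)          g _   = tt
applyUpTo-strictlyLogConcave (suc (suc zero))    g _   = tt
applyUpTo-strictlyLogConcave (suc (suc (suc L))) g slc =
  slc 0 (s≤s (s≤s (s≤s z≤n))) ,
  applyUpTo-strictlyLogConcave (suc (suc L)) (g ∘ suc) λ j 2+j<2+L → slc (suc j) (s≤s 2+j<2+L)

logConcave⇒strictlyLogConcave : ∀ {n x L} (g : ℕ → ℤ) → LogConcaveOn n x → L ≤ suc n →
  (∀ j → j < L → g j ≡ ℤ.+ x j) → StrictlyLogConcave (applyUpTo g L)
logConcave⇒strictlyLogConcave {n} {x} {L} g lc L≤1+n g≗x = applyUpTo-strictlyLogConcave L g interior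
  where
  products : ∀ j k → j < L → k < L → ℤ.+ (x j * x k) ≡ g j ℤ.* g k
  products j k j<L k<L = trans (ℤₚ.pos-* (x j) (x k)) (sym (cong₂ ℤ._*_ (g≗x j j<L) (g≗x k k<L)))

  interior : ∀ j → 2 + j < L → g j ℤ.* g (2 + j) ℤ.< g (1 + j) ℤ.* g (1 + j)
  interior j 2+j<L =
    subst₂ ℤ._<_ (products j (2 + j) (ℕₚ.<-trans (ℕₚ.m<n+m j (s≤s z≤n)) 2+j<L) 2+j<L)
                 (products (1 + j) (1 + j) 1+j<L 1+j<L)
      (+<+ (LogConcaveOn.strictly-concave lc (ℕₚ.≤-pred (ℕₚ.≤-trans 2+j<L L≤1+n))))
    where 1+j<L = ℕₚ.<-trans (ℕₚ.n<1+n (1 + j)) 2+j<L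

-- The two lines of Δ

applyUpTo-++ : ∀ {A : Set} (f : ℕ → A) m n → applyUpTo f (m + n) ≡ applyUpTo f m ++ applyUpTo (f ∘ (m +_)) n
applyUpTo-++ f zero    n = refl
applyUpTo-++ f (suc m) n = cong (f 0 ∷_) (applyUpTo-++ (f ∘ suc) m n)

filter-upTo-interval : ∀ {ℓ} {P : Pred ℕ ℓ} (P? : Decidable P) lo L →
  (∀ {i} → i < lo → ¬ P i) → (∀ {j} → j < L → P (lo + j)) → ¬ P (lo + L) →
  filter P? (upTo (lo + (L + 1))) ≡ applyUpTo (lo +_) L
filter-upTo-interval {P = P} P? lo L below inside above = begin
  filter P? (upTo (lo + (L + 1)))
    ≡⟨ cong (filter P?) (trans (applyUpTo-++ (λ i → i) lo (L + 1)) (cong (upTo lo ++_) (applyUpTo-++ (lo +_) L 1))) ⟩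
  filter P? (upTo lo ++ (applyUpTo (lo +_) L ++ applyUpTo (λ i → lo + (L + i)) 1))
    ≡⟨ trans (filter-++ P? (upTo lo) _) (cong (filter P? (upTo lo) ++_) (filter-++ P? (applyUpTo (lo +_) L) _)) ⟩
  filter P? (upTo lo) ++ (filter P? (applyUpTo (lo +_) L) ++ filter P? (applyUpTo (λ i → lo + (L + i)) 1))
    ≡⟨ cong₂ (λ xs ys → xs ++ (ys ++ filter P? (applyUpTo (λ i → lo + (L + i)) 1)))
             (filter-none P? (applyUpTo⁺₁ (λ i → i) lo below)) (filter-all P? (applyUpTo⁺₁ (lo +_) L inside)) ⟩
  applyUpTo (lo +_) L ++ filter P? (applyUpTo (λ i → lo + (L + i)) 1)
    ≡⟨ cong (applyUpTo (lo +_) L ++_) (filter-none P? (subst (λ m → ¬ P (lo + m)) (sym (ℕₚ.+-identityʳ L)) above ∷ [])) ⟩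
  applyUpTo (lo +_) L ++ []
    ≡⟨ ++-identityʳ _ ⟩
  applyUpTo (lo +_) L ∎
  where open ≡-Reasoning

line1-interval : ∀ {a b} → 1 ≤ a → a < b → line1 a b ≡ applyUpTo (a +_) (b ∸ 1)
line1-interval {suc a} {suc b} _ (s≤s a<b) =
  trans (cong (filter (λ i → InΔ? (suc a) (suc b) i 1) ∘ upTo) (cong (suc a +_) (ℕₚ.+-comm 1 b)))
        (filter-upTo-interval (λ i → InΔ? (suc a) (suc b) i 1) (suc a) b below inside above)
  where
  open ℕₚ.≤-Reasoning
  below : ∀ {i} → i < suc a → ¬ InΔ (suc a) (suc b) i 1
  below {i} (s≤s i≤a) (ab≤bi+a , _) = ℕₚ.<-irrefl refl (ℕₚ.≤-<-trans ab≤bi+a (begin-strict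
    suc b * i + suc a * 1   ≤⟨ ℕₚ.+-mono-≤ (ℕₚ.*-monoʳ-≤ (suc b) i≤a) (ℕₚ.≤-reflexive (ℕₚ.*-identityʳ (suc a))) ⟩
    suc b * a + suc a       <⟨ ℕₚ.+-monoʳ-< (suc b * a) (s≤s a<b) ⟩
    suc b * a + suc b       ≡⟨ rearrange a b ⟩
    suc a * suc b           ∎))
    where
    rearrange : ∀ a b → suc b * a + suc b ≡ suc a * suc b
    rearrange = ℕ-Solver.solve-∀
  inside : ∀ {j} → j < b → InΔ (suc a) (suc b) (suc a + j) 1
  inside {j} j<b = (begin
      suc a * suc b                         ≡⟨ ℕₚ.*-comm (suc a) (suc b) ⟩
      suc b * suc a                         ≤⟨ ℕₚ.*-monoʳ-≤ (suc b) (ℕₚ.m≤m+n (suc a) j) ⟩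
      suc b * (suc a + j)                   ≤⟨ ℕₚ.m≤m+n _ _ ⟩
      suc b * (suc a + j) + suc a * 1       ∎) ,
    (begin
      suc a + j + 1                         ≡⟨ rearrange a j ⟩
      a + suc j + 1                         ≤⟨ ℕₚ.+-monoˡ-≤ 1 (ℕₚ.+-monoʳ-≤ a j<b) ⟩
      a + b + 1                             ≡⟨ rearrange′ a b ⟩
      a + suc b                             ∎)
    where
    rearrange : ∀ a j → suc a + j + 1 ≡ a + suc j + 1
    rearrange = ℕ-Solver.solve-∀
    rearrange′ : ∀ a b → a + b + 1 ≡ a + suc b
    rearrange′ = ℕ-Solver.solve-∀
  above : ¬ InΔ (suc a) (suc b) (suc a + b) 1
  above (_ , a+b+2≤a+b+1) = ℕₚ.<-irrefl refl (ℕₚ.<-≤-trans (ℕₚ.≤-reflexive (rearrange a b)) a+b+2≤a+b+1)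
    where
    rearrange : ∀ a b → suc (a + suc b) ≡ suc a + b + 1
    rearrange = ℕ-Solver.solve-∀

line2-interval : ∀ {a b} → 2 ≤ a → a ≤ b → line2 a b ≡ applyUpTo (0 +_) (a + b ∸ 1)
line2-interval {suc zero} (s≤s ())
line2-interval {suc (suc a)} {suc b} _ a≤b =
  trans (cong (filter (InLine2? (2 + a) (suc b)) ∘ upTo ∘ suc) (ℕₚ.+-comm 1 D))
        (filter-upTo-interval (InLine2? (2 + a) (suc b)) 0 (suc D) (λ ()) inside above)
  where
  open ℕₚ.≤-Reasoning
  D = a + suc b
  inside : ∀ {j} → j < suc D → InLine2 (2 + a) (suc b) j
  inside {j} (s≤s j≤D) = j≤D , (begin
      (2 + a) * suc b                       ≤⟨ ℕₚ.*-monoʳ-≤ (2 + a) (ℕₚ.m≤n+m (suc b) a) ⟩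
      (2 + a) * D                           ≡⟨ cong ((2 + a) *_) (ℕₚ.m+[n∸m]≡n j≤D) ⟨
      (2 + a) * (j + (D ∸ j))               ≡⟨ ℕₚ.*-distribˡ-+ (2 + a) j (D ∸ j) ⟩
      (2 + a) * j + (2 + a) * (D ∸ j)       ≤⟨ ℕₚ.+-monoˡ-≤ _ (ℕₚ.*-monoˡ-≤ j a≤b) ⟩
      suc b * j + (2 + a) * (D ∸ j)         ∎) ,
    (begin
      j + (D ∸ j)                           ≡⟨ ℕₚ.m+[n∸m]≡n j≤D ⟩
      D                                     ≤⟨ ℕₚ.n≤1+n D ⟩
      suc D                                 ∎)
  above : ¬ InLine2 (2 + a) (suc b) (suc D)
  above (1+D≤D , _) = ℕₚ.<-irrefl refl 1+D≤D

line2-interval₁ : ∀ {b} → 2 ≤ b → line2 1 b ≡ applyUpTo (1 +_) (b ∸ 1)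
line2-interval₁ {suc zero} (s≤s ())
line2-interval₁ {suc (suc b)} _ =
  trans (cong (filter (InLine2? 1 (2 + b)) ∘ upTo ∘ suc ∘ suc) (ℕₚ.+-comm 1 b))
        (filter-upTo-interval (InLine2? 1 (2 + b)) 1 (suc b) below inside above)
  where
  open ℕₚ.≤-Reasoning
  below : ∀ {i} → i < 1 → ¬ InLine2 1 (2 + b) i
  below {suc i} (s≤s ())
  below {zero} _ (_ , b+2≤b+1 , _) = ℕₚ.<-irrefl refl (begin-strict
    suc b                   <⟨ ℕₚ.n<1+n (suc b) ⟩
    2 + b                   ≡⟨ ℕₚ.*-identityˡ (2 + b) ⟨
    1 * (2 + b)             ≤⟨ b+2≤b+1 ⟩
    (2 + b) * 0 + 1 * suc b ≡⟨ cong₂ _+_ (ℕₚ.*-zeroʳ (2 + b)) (ℕₚ.*-identityˡ (suc b)) ⟩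
    suc b                   ∎)
  inside : ∀ {j} → j < suc b → InLine2 1 (2 + b) (1 + j)
  inside {j} (s≤s j≤b) = s≤s j≤b , (begin
      1 * (2 + b)                           ≡⟨ ℕₚ.*-identityˡ (2 + b) ⟩
      2 + b                                 ≡⟨ ℕₚ.*-identityʳ (2 + b) ⟨
      (2 + b) * 1                           ≤⟨ ℕₚ.*-monoʳ-≤ (2 + b) (s≤s z≤n) ⟩
      (2 + b) * (1 + j)                     ≤⟨ ℕₚ.m≤m+n _ _ ⟩
      (2 + b) * (1 + j) + 1 * (b ∸ j)       ∎) ,
    (begin
      1 + j + (b ∸ j)                       ≡⟨ cong suc (ℕₚ.m+[n∸m]≡n j≤b) ⟩
      suc b                                 ≤⟨ ℕₚ.n≤1+n (suc b) ⟩
      2 + b                                 ∎)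
  above : ¬ InLine2 1 (2 + b) (1 + suc b)
  above (2+b≤1+b , _) = ℕₚ.<-irrefl refl 2+b≤1+b

-- Slices of the Markov numerators

profile₁ profile₂ : ℕ → ℕ → Profile
profile₁ a b = profile a b (ℤ.+ (3 * a) -ᶻ 1ℤ) (ℤ.+ (a + b) -ᶻ 1ℤ)
profile₂ a b = profile 0 (a + b) (ℤ.+ a -ᶻ 1ℤ) (ℤ.+ b -ᶻ 1ℤ)

pred-midpoint : ∀ m n k → m + n ≡ k + k → (ℤ.+ m -ᶻ 1ℤ) +ᶻ (ℤ.+ n -ᶻ 1ℤ) ≡ (ℤ.+ k -ᶻ 1ℤ) +ᶻ (ℤ.+ k -ᶻ 1ℤ)
pred-midpoint m n k m+n≡2k = begin
  (ℤ.+ m -ᶻ 1ℤ) +ᶻ (ℤ.+ n -ᶻ 1ℤ)   ≡⟨ regroup (ℤ.+ m) (ℤ.+ n) ⟩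
  (ℤ.+ m +ᶻ ℤ.+ n) -ᶻ (1ℤ +ᶻ 1ℤ)   ≡⟨ cong (_-ᶻ (1ℤ +ᶻ 1ℤ)) (ℤₚ.pos-+ m n) ⟨
  ℤ.+ (m + n) -ᶻ (1ℤ +ᶻ 1ℤ)        ≡⟨ cong (λ j → ℤ.+ j -ᶻ (1ℤ +ᶻ 1ℤ)) m+n≡2k ⟩
  ℤ.+ (k + k) -ᶻ (1ℤ +ᶻ 1ℤ)        ≡⟨ cong (_-ᶻ (1ℤ +ᶻ 1ℤ)) (ℤₚ.pos-+ k k) ⟩
  (ℤ.+ k +ᶻ ℤ.+ k) -ᶻ (1ℤ +ᶻ 1ℤ)   ≡⟨ regroup (ℤ.+ k) (ℤ.+ k) ⟨
  (ℤ.+ k -ᶻ 1ℤ) +ᶻ (ℤ.+ k -ᶻ 1ℤ)   ∎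
  where
  open ≡-Reasoning
  regroup : ∀ a b → (a -ᶻ 1ℤ) +ᶻ (b -ᶻ 1ℤ) ≡ (a +ᶻ b) -ᶻ (1ℤ +ᶻ 1ℤ)
  regroup = solve-∀

module _ (ac bc aG bG aμ bμ : ℕ) (a-mid : ac + aG ≡ aμ + aμ) (b-mid : bc + bG ≡ bμ + bμ) where

  sum-midpoint : (ac + bc) + (aG + bG) ≡ (aμ + bμ) + (aμ + bμ)
  sum-midpoint = trans (+-interchange ac bc aG bG) (trans (cong₂ _+_ a-mid b-mid) (+-interchange aμ aμ bμ bμ))

  profile₁-midpoint : Midpoint (profile₁ ac bc) (profile₁ aG bG) (profile₁ aμ bμ)
  profile₁-midpoint = record
    { x-mid = a-mid
    ; y-mid = b-mid
    ; α-mid = pred-midpoint (3 * ac) (3 * aG) (3 * aμ)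
                (trans (sym (ℕₚ.*-distribˡ-+ 3 ac aG)) (trans (cong (3 *_) a-mid) (ℕₚ.*-distribˡ-+ 3 aμ aμ)))
    ; β-mid = pred-midpoint (ac + bc) (aG + bG) (aμ + bμ) sum-midpoint
    }

  profile₂-midpoint : Midpoint (profile₂ ac bc) (profile₂ aG bG) (profile₂ aμ bμ)
  profile₂-midpoint = record
    { x-mid = refl
    ; y-mid = sum-midpoint
    ; α-mid = pred-midpoint ac aG aμ a-mid
    ; β-mid = pred-midpoint bc bG bμ b-mid
    }

U^-shift : ∀ a F j k → (U ^ a) F (a + j) k ≡ F j k
U^-shift zero    F j k = refl
U^-shift (suc a) F j k = U^-shift a F j k

lin-antidiagonal : ∀ α β j k → j + k ≡ 1 → lin (ℤ.+ α) (ℤ.+ β) j k ≡ ℤ.+ two-terms α β j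
lin-antidiagonal α β zero       (suc zero) _ = refl
lin-antidiagonal α β (suc zero) zero       _ = refl
lin-antidiagonal α β zero       zero       ()
lin-antidiagonal α β zero       (suc (suc k)) ()
lin-antidiagonal α β (suc zero) (suc k)    ()
lin-antidiagonal α β (suc (suc j)) k       ()

const-antidiagonal : ∀ α j k → j + k ≡ 0 → const (ℤ.+ α) j k ≡ ℤ.+ two-terms α 0 j
const-antidiagonal α zero zero _ = refl

lin-0 : ∀ β → lin 0ℤ β ≋ U (const β)
lin-0 β = pointwise coefficients
  where
  coefficients : ∀ i k → lin 0ℤ β i k ≡ U (const β) i k
  coefficients zero          zero          = refl
  coefficients zero          (suc zero)    = refl
  coefficients zero          (suc (suc k)) = refl
  coefficients (suc zero)    zero          = refl
  coefficients (suc zero)    (suc k)       = refl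
  coefficients (suc (suc i)) zero          = refl
  coefficients (suc (suc i)) (suc k)       = refl

-- The exponent of w in coeffA P (1 + a) (3 + m) (1 + a + j) 1 puts it on the antidiagonal m + 1.
line1-exponent : ∀ a m j → j ≤ suc m → j + (a + (3 + m) ∸ suc (a + j) ∸ 1) ≡ m + 1
line1-exponent zero m j j≤1+m = begin
  j + ((2 + m) ∸ j ∸ 1)     ≡⟨ cong (λ n → j + (n ∸ 1)) (ℕₚ.+-∸-assoc 1 j≤1+m) ⟩
  j + (suc m ∸ j)           ≡⟨ ℕₚ.m+[n∸m]≡n j≤1+m ⟩
  suc m                     ≡⟨ ℕₚ.+-comm 1 m ⟩
  m + 1                     ∎
  where open ≡-Reasoning
line1-exponent (suc a) m j j≤1+m = line1-exponent a m j j≤1+m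

[1+n∸i]∸[n∸i]≡1 : ∀ n i → i ≤ n → (suc n ∸ i) ∸ (n ∸ i) ≡ 1
[1+n∸i]∸[n∸i]≡1 n i i≤n = trans (cong (_∸ (n ∸ i)) (ℕₚ.+-∸-assoc 1 i≤n)) (ℕₚ.m+n∸n≡m 1 (n ∸ i))

module Markov (P : ℕ → ℕ → Ser) (H : IsMarkovNumerators P) where

  P01≈1 : P 0 1 ≈ mono 0 0 0
  P01≈1 = proj₁ H

  P10≈1 : P 1 0 ≈ mono 0 0 0
  P10≈1 = proj₁ (proj₂ H)

  P11≈u+v : P 1 1 ≈ mono 1 0 0 ⊕ mono 0 1 0
  P11≈u+v = proj₁ (proj₂ (proj₂ H))

  markov-left : ∀ {p q r s} → q * r ≡ p * s + 1 →
    P (p + (p + r)) (q + (q + s)) ⊗ P r s ≈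
      mono r s (r + s) ⊗ (P p q ⊗ P p q) ⊕ P (p + r) (q + s) ⊗ P (p + r) (q + s)
  markov-left {p} {q} {r} {s} det =
    subst₂ (λ a b → P a b ⊗ P r s ≈ mono r s (r + s) ⊗ (P p q ⊗ P p q) ⊕ Pμ ⊗ Pμ) (twice p r) (twice q s)
           (proj₁ (proj₂ (proj₂ (proj₂ H))) p q r s det)
    where
    Pμ = P (p + r) (q + s)
    twice : ∀ p r → 2 * p + r ≡ p + (p + r)
    twice = ℕ-Solver.solve-∀

  markov-right : ∀ {p q r s} → q * r ≡ p * s + 1 →
    P ((p + r) + r) ((q + s) + s) ⊗ P p q ≈
      mono p q (p + q) ⊗ (P r s ⊗ P r s) ⊕ P (p + r) (q + s) ⊗ P (p + r) (q + s)
  markov-right {p} {q} {r} {s} det i j k =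
    trans (subst₂ (λ a b → P a b ⊗ P p q ≈ Pμ ⊗ Pμ ⊕ M ⊗ (P r s ⊗ P r s)) (twice p r) (twice q s)
                  (proj₂ (proj₂ (proj₂ (proj₂ H))) p q r s det) i j k)
          (ℤₚ.+-comm ((Pμ ⊗ Pμ) i j k) ((M ⊗ (P r s ⊗ P r s)) i j k))
    where
    Pμ = P (p + r) (q + s)
    M = mono p q (p + q)
    twice : ∀ p r → p + 2 * r ≡ (p + r) + r
    twice = ℕ-Solver.solve-∀

  module Line (S : Slicing) (prof : ℕ → ℕ → Profile)
    (prof-midpoint : ∀ ac bc aG bG aμ bμ → ac + aG ≡ aμ + aμ → bc + bG ≡ bμ + bμ →
                     Midpoint (prof ac bc) (prof aG bG) (prof aμ bμ))
    (Regular : ℕ → ℕ → Set) where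
    -- Regular singles out the fractions whose order-1 slice has the shape; the others
    -- enter only as G in special steps, through the compensation lemmas.
    open Slicing S
    open Jets S

    Order₀ : ℕ → ℕ → Set
    Order₀ a b = T (slice₀ (P a b)) ≋ UT (x (prof a b)) (y (prof a b)) one

    ShapeAt : ℕ → ℕ → Set
    ShapeAt a b = Shape (prof a b) (slice₀ (P a b)) (slice₁ (P a b))

    Compensates : (c G : Profile) → Ser₂ → Ser₂ → Set
    Compensates c G G₁ E = UT (x c) (y c) ((T ^ 3) G₁) ≋ UT (x c + x G) (y c + y G) (lin (α G) (β G)) ⊞ (T ^ 4) E

    private
      left-midpoint : ∀ p r → (p + (p + r)) + r ≡ (p + r) + (p + r)
      left-midpoint = ℕ-Solver.solve-∀
      right-midpoint : ∀ p r → ((p + r) + r) + p ≡ (p + r) + (p + r)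
      right-midpoint = ℕ-Solver.solve-∀
      extra-term-vanishes : ∀ {M₁} F → M₁ ≋ 𝟘 → M₁ ⊛ F ≋ 𝟘
      extra-term-vanishes F M₁≋𝟘 = ≋-trans (⊛-congʳ F M₁≋𝟘) (⊛-zeroˡ F)

    left-step : ∀ {p q r s} → q * r ≡ p * s + 1 → slice₀ (mono r s (r + s)) ≋ 𝟘 →
      Order₀ r s → ShapeAt (p + r) (q + s) →
      Compensates (prof (p + (p + r)) (q + (q + s))) (prof r s) (slice₁ (P r s))
                  (slice₁ (mono r s (r + s)) ⊛ (slice₀ (P p q) ⊛ slice₀ (P p q))) →
      ShapeAt (p + (p + r)) (q + (q + s))
    left-step {p} {q} {r} {s} det M₀≋𝟘 G₀ μ compensation =
      midpoint-step (prof-midpoint _ _ _ _ _ _ (left-midpoint p r) (left-midpoint q s)) G₀ μ compensation (proj₁ rel) (proj₂ rel)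
      where rel = sliced-relation (markov-left det) M₀≋𝟘

    left-step-regular : ∀ {p q r s} → q * r ≡ p * s + 1 →
      slice₀ (mono r s (r + s)) ≋ 𝟘 → slice₁ (mono r s (r + s)) ≋ 𝟘 →
      ShapeAt r s → ShapeAt (p + r) (q + s) → ShapeAt (p + (p + r)) (q + (q + s))
    left-step-regular {p} {q} {r} {s} det M₀≋𝟘 M₁≋𝟘 G μ =
      midpoint-step-regular (prof-midpoint _ _ _ _ _ _ (left-midpoint p r) (left-midpoint q s)) G μ
        (extra-term-vanishes (slice₀ (P p q) ⊛ slice₀ (P p q)) M₁≋𝟘) (proj₁ rel) (proj₂ rel)
      where rel = sliced-relation (markov-left det) M₀≋𝟘

    right-step : ∀ {p q r s} → q * r ≡ p * s + 1 → slice₀ (mono p q (p + q)) ≋ 𝟘 →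
      Order₀ p q → ShapeAt (p + r) (q + s) →
      Compensates (prof ((p + r) + r) ((q + s) + s)) (prof p q) (slice₁ (P p q))
                  (slice₁ (mono p q (p + q)) ⊛ (slice₀ (P r s) ⊛ slice₀ (P r s))) →
      ShapeAt ((p + r) + r) ((q + s) + s)
    right-step {p} {q} {r} {s} det M₀≋𝟘 G₀ μ compensation =
      midpoint-step (prof-midpoint _ _ _ _ _ _ (right-midpoint p r) (right-midpoint q s)) G₀ μ compensation (proj₁ rel) (proj₂ rel)
      where rel = sliced-relation (markov-right det) M₀≋𝟘

    right-step-regular : ∀ {p q r s} → q * r ≡ p * s + 1 →
      slice₀ (mono p q (p + q)) ≋ 𝟘 → slice₁ (mono p q (p + q)) ≋ 𝟘 →
      ShapeAt p q → ShapeAt (p + r) (q + s) → ShapeAt ((p + r) + r) ((q + s) + s)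
    right-step-regular {p} {q} {r} {s} det M₀≋𝟘 M₁≋𝟘 G μ =
      midpoint-step-regular (prof-midpoint _ _ _ _ _ _ (right-midpoint p r) (right-midpoint q s)) G μ
        (extra-term-vanishes (slice₀ (P r s) ⊛ slice₀ (P r s)) M₁≋𝟘) (proj₁ rel) (proj₂ rel)
      where rel = sliced-relation (markov-right det) M₀≋𝟘

    record Claim (p q r s : ℕ) : Set where
      field
        left-order₀   : Order₀ p q
        right-order₀  : Order₀ r s
        left-shape    : Regular p q → ShapeAt p q
        right-shape   : Regular r s → ShapeAt r s
        mediant-shape : ShapeAt (p + r) (q + s)

    claims : Claim 0 1 1 1 →
      (∀ {p q r s} → Descendant 0 1 1 1 p q r s → Claim p q r s → ShapeAt (p + (p + r)) (q + (q + s))) →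
      (∀ {p q r s} → Descendant 0 1 1 1 p q r s → Claim p q r s → ShapeAt ((p + r) + r) ((q + s) + s)) →
      ∀ {p q r s} → Descendant 0 1 1 1 p q r s → Claim p q r s
    claims root-claim new-left new-right root = root-claim
    claims root-claim new-left new-right (left d) = record
      { left-order₀   = left-order₀
      ; right-order₀  = order₀ mediant-shape
      ; left-shape    = left-shape
      ; right-shape   = λ _ → mediant-shape
      ; mediant-shape = new-left d claim
      }
      where
      claim = claims root-claim new-left new-right d
      open Claim claim
    claims root-claim new-left new-right (right d) = record
      { left-order₀   = order₀ mediant-shape
      ; right-order₀  = right-order₀
      ; left-shape    = λ _ → mediant-shape
      ; right-shape   = right-shape
      ; mediant-shape = new-right d claim
      }
      where
      claim = claims root-claim new-left new-right d
      open Claim claim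

  module Line₁ where
    open Line v-slicing profile₁ profile₁-midpoint (λ _ b → 2 ≤ b) public
    open Jets v-slicing

    mono-jet₀ : ∀ r t → Jet (mono r 0 t) (monomial r t) 𝟘
    mono-jet₀ r t = jet (v-slice-mono r 0 t) (v-slice-mono-≢ r t λ ())

    mono-jet₁ : ∀ r t → Jet (mono r 1 t) 𝟘 (monomial r t)
    mono-jet₁ r t = jet (v-slice-mono-≢ r t λ ()) (v-slice-mono r 1 t)

    P01-jet : Jet (P 0 1) one 𝟘
    P01-jet = jet-≈ P01≈1 (mono-jet₀ 0 0)

    P10-jet : Jet (P 1 0) one 𝟘
    P10-jet = jet-≈ P10≈1 (mono-jet₀ 0 0)

    P11-jet : Jet (P 1 1) (U one) one
    P11-jet = jet-resp (⊞-identityʳ (U one)) (⊞-identityˡ one) (jet-≈ P11≈u+v (jet-⊕ (mono-jet₀ 1 0) (mono-jet₁ 0 0)))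

    order₀-0/1 : Order₀ 0 1
    order₀-0/1 = IsMultiplier.resp-≋ T-isMultiplier (Jet.jet₀ P01-jet)

    order₀-1/1 : Order₀ 1 1
    order₀-1/1 = ≋-trans (IsMultiplier.resp-≋ T-isMultiplier (Jet.jet₀ P11-jet))
                         (multipliers-commute T-isMultiplier U-isMultiplier one)

    shape-1/2 : ShapeAt 1 2
    shape-1/2 = record
      { order₀ = begin
          T (v-slice 0 (P 1 2))         ≈⟨ T.resp-≋ (proj₁ P12-slices) ⟩
          T (U (W one) ⊞ U one ⊛ U one) ≈⟨ T.resp-≋ (⊞-congˡ (U (W one)) (≋-trans (U-⊛ˡ one (U one)) (U.resp-≋ (⊛-identityˡ _)))) ⟩
          T (U (W one) ⊞ U (U one))     ≈⟨ T.resp-≋ (≋-trans (U.resp-≋ (⊞-comm (U one) (W one))) (U.distrib (W one) (U one))) ⟨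
          T (U (T one))                 ≈⟨ multipliers-commute T-isMultiplier U-isMultiplier (T one) ⟩
          UT 1 2 one                    ∎
      ; order₁ = begin
          (T ^ 3) (v-slice 1 (P 1 2))            ≈⟨ T³.resp-≋ (proj₂ P12-slices) ⟩
          (T ^ 3) (𝟘 ⊞ (U one ⊛ one ⊞ one ⊛ U one))
            ≈⟨ T³.resp-≋ (≋-trans (⊞-identityˡ _) (⊞-cong (⊛-identityʳ (U one)) (⊛-identityˡ (U one)))) ⟩
          (T ^ 3) (U one ⊞ U one)                ≈⟨ T³.resp-≋ (U.distrib one one) ⟨
          (T ^ 3) (U (one ⊞ one))                ≈⟨ multipliers-commute (^-isMultiplier T-isMultiplier 3) U-isMultiplier _ ⟩
          U ((T ^ 3) (one ⊞ one))                ≈⟨ U.resp-≋ (IsMultiplier.resp-≋ (^-isMultiplier T-isMultiplier 2) T[2]) ⟩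
          UT 1 2 (lin (ℤ.+ 2) (ℤ.+ 2))           ∎
      }
      where
      open ≋-Reasoning
      module T = IsMultiplier T-isMultiplier
      module U = IsMultiplier U-isMultiplier
      module T³ = IsMultiplier (^-isMultiplier T-isMultiplier 3)
      P12-slices = jet-unique (jet-⊗-unitʳ (slices (P 1 2)) P10-jet)
        (jet-≈ (markov-left {0} {1} {1} {0} refl)
               (jet-⊕ (jet-⊗-unitʳ (mono-jet₀ 1 1) (jet-⊗-unitʳ P01-jet P01-jet)) (jet-⊗ P11-jet P11-jet)))
      T[2] : T (one ⊞ one) ≋ lin (ℤ.+ 2) (ℤ.+ 2)
      T[2] = pointwise λ { zero zero → refl ; zero (suc zero) → refl ; zero (suc (suc k)) → refl
                         ; (suc zero) zero → refl ; (suc zero) (suc k) → refl ; (suc (suc i)) zero → refl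
                         ; (suc (suc i)) (suc k) → refl }

    root-claim : Claim 0 1 1 1
    root-claim = record
      { left-order₀   = order₀-0/1
      ; right-order₀  = order₀-1/1
      ; left-shape    = λ { (s≤s ()) }
      ; right-shape   = λ { (s≤s ()) }
      ; mediant-shape = shape-1/2
      }

    left-step-1/1 : ∀ {p} → Order₀ p (p + 1) → ShapeAt (p + 1) ((p + 1) + 1) →
      ShapeAt (p + (p + 1)) ((p + 1) + ((p + 1) + 1))
    left-step-1/1 {p} L₀ μ =
      left-step {p} {p + 1} {1} {1} det (v-slice-mono-≢ 1 2 λ ()) order₀-1/1 μ
        (compensation-1/1 {xL = p} {p + 1} (p + (p + 1)) ((p + 1) + ((p + 1) + 1)) _ _
                          (Jet.jet₁ P11-jet) (v-slice-mono 1 1 2) L₀ (x-eq p) (y-eq p) refl refl)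
      where
      det : (p + 1) * 1 ≡ p * 1 + 1
      det = trans (ℕₚ.*-identityʳ (p + 1)) (cong (_+ 1) (sym (ℕₚ.*-identityʳ p)))
      x-eq : ∀ p → p + (p + 1) ≡ suc (p + p)
      x-eq = ℕ-Solver.solve-∀
      y-eq : ∀ p → suc ((p + 1) + ((p + 1) + 1)) ≡ suc (p + 1) + suc (p + 1)
      y-eq = ℕ-Solver.solve-∀

    right-step-0/1 : ∀ {s} → Order₀ 1 s → ShapeAt 1 (1 + s) → ShapeAt 2 ((1 + s) + s)
    right-step-0/1 {s} R₀ μ =
      right-step {0} {1} {1} {s} refl (v-slice-mono-≢ 0 1 λ ()) order₀-0/1 μ
        (compensation-0/1 {xR = 1} {s} 2 ((1 + s) + s) _ _ (Jet.jet₁ P01-jet) (v-slice-mono 0 1 1) R₀ refl (y-eq s))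
      where
      y-eq : ∀ s → ((1 + s) + s) + 1 ≡ suc s + suc s
      y-eq = ℕ-Solver.solve-∀

    new-left : ∀ {p q r s} → Descendant 0 1 1 1 p q r s → Claim p q r s → ShapeAt (p + (p + r)) (q + (q + s))
    new-left {p} {q} {r} {s} d claim with 2 ≤? s
    ... | yes 2≤s = left-step-regular (descendant-det d refl)
                      (v-slice-mono-≢ r (r + s) (0≢s ∘ sym)) (v-slice-mono-≢ r (r + s) (1≢s ∘ sym))
                      (right-shape 2≤s) mediant-shape
      where
      open Claim claim
      0≢s : ¬ s ≡ 0
      0≢s refl = contradiction 2≤s λ ()
      1≢s : ¬ s ≡ 1
      1≢s refl = contradiction 2≤s λ { (s≤s ()) }
    ... | no 2≰s with right-end d (ℕₚ.≰⇒> 2≰s)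
    ...   | refl , refl , refl = left-step-1/1 left-order₀ mediant-shape
      where open Claim claim

    new-right : ∀ {p q r s} → Descendant 0 1 1 1 p q r s → Claim p q r s → ShapeAt ((p + r) + r) ((q + s) + s)
    new-right {p} {q} {r} {s} d claim with 2 ≤? q
    ... | yes 2≤q = right-step-regular (descendant-det d refl)
                      (v-slice-mono-≢ p (p + q) (0≢q ∘ sym)) (v-slice-mono-≢ p (p + q) (1≢q ∘ sym))
                      (left-shape 2≤q) mediant-shape
      where
      open Claim claim
      0≢q : ¬ q ≡ 0
      0≢q refl = contradiction 2≤q λ ()
      1≢q : ¬ q ≡ 1
      1≢q refl = contradiction 2≤q λ { (s≤s ()) }
    ... | no 2≰q with left-end d (ℕₚ.≰⇒> 2≰q)
    ...   | refl , refl , refl = right-step-0/1 right-order₀ mediant-shape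
      where open Claim claim

    shape : ∀ {p q r s} → Descendant 0 1 1 1 p q r s → ShapeAt (p + r) (q + s)
    shape = Claim.mediant-shape ∘ claims root-claim new-left new-right

  module Line₂ where
    open Line w-slicing profile₂ profile₂-midpoint (λ a b → 2 ≤ a + b) public
    open Jets w-slicing

    mono-jet₀ : ∀ r s → Jet (mono r s 0) (monomial r s) 𝟘
    mono-jet₀ r s = jet (w-slice-mono r s 0) (w-slice-mono-≢ r s λ ())

    mono-jet₁ : ∀ r s → Jet (mono r s 1) 𝟘 (monomial r s)
    mono-jet₁ r s = jet (w-slice-mono-≢ r s λ ()) (w-slice-mono r s 1)

    P01-jet : Jet (P 0 1) one 𝟘
    P01-jet = jet-≈ P01≈1 (mono-jet₀ 0 0)

    P10-jet : Jet (P 1 0) one 𝟘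
    P10-jet = jet-≈ P10≈1 (mono-jet₀ 0 0)

    P11-jet : Jet (P 1 1) (T one) 𝟘
    P11-jet = jet-resp ≋-refl (⊞-identityˡ 𝟘) (jet-≈ P11≈u+v (jet-⊕ (mono-jet₀ 1 0) (mono-jet₀ 0 1)))

    order₀-0/1 : Order₀ 0 1
    order₀-0/1 = IsMultiplier.resp-≋ T-isMultiplier (Jet.jet₀ P01-jet)

    shape-1/1 : ShapeAt 1 1
    shape-1/1 = record
      { order₀ = IsMultiplier.resp-≋ T-isMultiplier (Jet.jet₀ P11-jet)
      ; order₁ = begin
          (T ^ 3) (w-slice 1 (P 1 1))  ≈⟨ T³.resp-≋ (Jet.jet₁ P11-jet) ⟩
          (T ^ 3) 𝟘                    ≈⟨ multiplier-𝟘 (^-isMultiplier T-isMultiplier 3) ⟩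
          𝟘                            ≈⟨ multiplier-𝟘 (UT-isMultiplier 0 2) ⟨
          UT 0 2 𝟘                     ≈⟨ IsMultiplier.resp-≋ (UT-isMultiplier 0 2) lin-zero ⟨
          UT 0 2 (lin 0ℤ 0ℤ)           ∎
      }
      where
      open ≋-Reasoning
      module T³ = IsMultiplier (^-isMultiplier T-isMultiplier 3)

    shape-1/2 : ShapeAt 1 2
    shape-1/2 = record
      { order₀ = begin
          T (w-slice 0 (P 1 2))         ≈⟨ T.resp-≋ (proj₁ P12-slices) ⟩
          T (𝟘 ⊞ T one ⊛ T one)         ≈⟨ T.resp-≋ (≋-trans (T^-⊛ 1 1 one one) (≋-sym (⊞-identityˡ (T one ⊛ T one)))) ⟨
          T ((T ^ 2) (one ⊛ one))       ≈⟨ T.resp-≋ (IsMultiplier.resp-≋ (^-isMultiplier T-isMultiplier 2) (⊛-identityˡ one)) ⟩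
          UT 0 3 one                    ∎
      ; order₁ = begin
          (T ^ 3) (w-slice 1 (P 1 2))                   ≈⟨ T³.resp-≋ (proj₂ P12-slices) ⟩
          (T ^ 3) (U one ⊞ (T one ⊛ 𝟘 ⊞ 𝟘 ⊛ T one))
            ≈⟨ T³.resp-≋ (≋-trans (⊞-congˡ (U one) (≋-trans (⊞-cong (⊛-zeroʳ (T one)) (⊛-zeroˡ (T one))) (⊞-identityˡ 𝟘)))
                                  (⊞-identityʳ (U one))) ⟩
          (T ^ 3) (U one)                               ≈⟨ T³.resp-≋ U-one ⟩
          UT 0 3 (lin 0ℤ 1ℤ)                            ∎
      }
      where
      open ≋-Reasoning
      module T = IsMultiplier T-isMultiplier
      module T³ = IsMultiplier (^-isMultiplier T-isMultiplier 3)
      P12-slices = jet-unique (jet-⊗-unitʳ (slices (P 1 2)) P10-jet)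
        (jet-≈ (markov-left {0} {1} {1} {0} refl)
               (jet-⊕ (jet-⊗-unitʳ (mono-jet₁ 1 0) (jet-⊗-unitʳ P01-jet P01-jet)) (jet-⊗ P11-jet P11-jet)))
      U-one : U one ≋ lin 0ℤ 1ℤ
      U-one = pointwise λ { zero zero → refl ; zero (suc zero) → refl ; zero (suc (suc k)) → refl
                          ; (suc zero) zero → refl ; (suc zero) (suc k) → refl ; (suc (suc i)) k → refl }

    root-claim : Claim 0 1 1 1
    root-claim = record
      { left-order₀   = order₀-0/1
      ; right-order₀  = order₀ shape-1/1
      ; left-shape    = λ { (s≤s ()) }
      ; right-shape   = λ _ → shape-1/1
      ; mediant-shape = shape-1/2
      }

    right-step-0/1 : ∀ {s} → Order₀ 1 s → ShapeAt 1 (1 + s) → ShapeAt 2 ((1 + s) + s)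
    right-step-0/1 {s} R₀ μ =
      right-step {0} {1} {1} {s} refl (w-slice-mono-≢ 0 1 λ ()) order₀-0/1 μ
        (compensation-0/1 {xR = 0} {1 + s} 0 (2 + ((1 + s) + s)) _ _ (Jet.jet₁ P01-jet) (w-slice-mono 0 1 1) R₀ refl (y-eq s))
      where
      y-eq : ∀ s → (2 + ((1 + s) + s)) + 1 ≡ suc (1 + s) + suc (1 + s)
      y-eq = ℕ-Solver.solve-∀

    new-left : ∀ {p q r s} → Descendant 0 1 1 1 p q r s → Claim p q r s → ShapeAt (p + (p + r)) (q + (q + s))
    new-left {p} {q} {r} {s} d claim =
      left-step-regular (descendant-det d refl) (w-slice-mono-≢ r s (0≢r+s ∘ sym)) (w-slice-mono-≢ r s (1≢r+s ∘ sym))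
        (right-shape 2≤r+s) mediant-shape
      where
      open Claim claim
      1≤r = det⇒numerator-pos {p} {q} {r} {s} (descendant-det d refl)
      2≤r+s : 2 ≤ r + s
      2≤r+s = ℕₚ.+-mono-≤ 1≤r (ℕₚ.≤-trans 1≤r (proj₂ (descendant-below-one d)))
      0≢r+s : ¬ r + s ≡ 0
      0≢r+s e = contradiction (subst (2 ≤_) e 2≤r+s) λ ()
      1≢r+s : ¬ r + s ≡ 1
      1≢r+s e = contradiction (subst (2 ≤_) e 2≤r+s) λ { (s≤s ()) }

    new-right : ∀ {p q r s} → Descendant 0 1 1 1 p q r s → Claim p q r s → ShapeAt ((p + r) + r) ((q + s) + s)
    new-right {p} {q} {r} {s} d claim with 2 ≤? p + q
    ... | yes 2≤p+q = right-step-regular (descendant-det d refl)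
                        (w-slice-mono-≢ p q (0≢p+q ∘ sym)) (w-slice-mono-≢ p q (1≢p+q ∘ sym))
                        (left-shape 2≤p+q) mediant-shape
      where
      open Claim claim
      0≢p+q : ¬ p + q ≡ 0
      0≢p+q e = contradiction (subst (2 ≤_) e 2≤p+q) λ ()
      1≢p+q : ¬ p + q ≡ 1
      1≢p+q e = contradiction (subst (2 ≤_) e 2≤p+q) λ { (s≤s ()) }
    ... | no 2≰p+q with left-end d (ℕₚ.<-≤-trans (s≤s (ℕₚ.m≤n+m q p)) (ℕₚ.≰⇒> 2≰p+q))
    ...   | refl , refl , refl = right-step-0/1 right-order₀ mediant-shape
      where open Claim claim

    shape : ∀ {p q r s} → Descendant 0 1 1 1 p q r s → ShapeAt (p + r) (q + s)
    shape = Claim.mediant-shape ∘ claims root-claim new-left new-right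

  seq1-strictlyLogConcave : ∀ {a b} → 1 ≤ a → a < b → Line₁.ShapeAt a b → StrictlyLogConcave (seq1 P a b)
  seq1-strictlyLogConcave {suc zero}    {suc zero}          _ (s≤s ()) _
  seq1-strictlyLogConcave {suc zero}    {suc (suc zero)}    _ _ _ = tt
  seq1-strictlyLogConcave {suc (suc a)} {suc (suc zero)}    _ (s≤s (s≤s ())) _
  seq1-strictlyLogConcave {suc a}       {suc (suc (suc m))} _ a<b shape =
    subst StrictlyLogConcave (sym sequence)
      (logConcave⇒strictlyLogConcave (λ j → coeffA P (suc a) b (suc a + j) 1) (pascalⁿ-logConcave (two-terms-logConcave α′>0 β′>0) m)
        (s≤s (ℕₚ.≤-reflexive (ℕₚ.+-comm 1 m))) coefficient)
    where
    b = suc (suc (suc m))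
    α′ = 3 * suc a ∸ 1
    β′ = suc a + b ∸ 1
    α′>0 : 0 < α′
    α′>0 = ℕₚ.<-≤-trans (s≤s z≤n) (ℕₚ.m≤n+m (2 * suc a) a)
    β′>0 : 0 < β′
    β′>0 = ℕₚ.<-≤-trans (s≤s z≤n) (ℕₚ.m≤n+m b a)
    slice : v-slice 1 (P (suc a) b) ≋ UT (suc a) m (lin (ℤ.+ α′) (ℤ.+ β′))
    slice = ^-injective T-injective 3 (≋-trans (order₁ shape) (≋-sym (T^-UT 3 (suc a) m _)))
    sequence : seq1 P (suc a) b ≡ applyUpTo (λ j → coeffA P (suc a) b (suc a + j) 1) (b ∸ 1)
    sequence = trans (cong (map (λ i → coeffA P (suc a) b i 1)) (line1-interval (s≤s z≤n) a<b))
                     (map-applyUpTo (suc a +_) (λ i → coeffA P (suc a) b i 1) (b ∸ 1))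
    coefficient : ∀ j → j < b ∸ 1 → coeffA P (suc a) b (suc a + j) 1 ≡ ℤ.+ pascalⁿ m (two-terms α′ β′) j
    coefficient j (s≤s j≤1+m) = begin
      P (suc a) b (suc a + j) 1 k
        ≡⟨ at slice (suc a + j) k ⟩
      UT (suc a) m (lin (ℤ.+ α′) (ℤ.+ β′)) (suc a + j) k
        ≡⟨ U^-shift (suc a) _ j k ⟩
      (T ^ m) (lin (ℤ.+ α′) (ℤ.+ β′)) j k
        ≡⟨ T^-antidiagonal (lin-antidiagonal α′ β′) vanishes m j k (line1-exponent a m j j≤1+m) ⟩
      ℤ.+ pascalⁿ m (two-terms α′ β′) j ∎
      where
      open ≡-Reasoning
      k = a + b ∸ suc (a + j) ∸ 1
      vanishes : ∀ {j} → 1 < j → two-terms α′ β′ j ≡ 0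
      vanishes {suc zero}    (s≤s ())
      vanishes {suc (suc j)} _ = refl

  seq2-strictlyLogConcave : ∀ {a b} → 1 ≤ a → a < b → Line₂.ShapeAt a b → StrictlyLogConcave (seq2 P a b)
  seq2-strictlyLogConcave {suc zero} {suc zero} _ (s≤s ()) _
  -- For a = 1 the coefficient a − 1 of v vanishes, and the line starts at i = 1: the factor u
  -- of the remaining term is split off.
  seq2-strictlyLogConcave {suc zero} {suc (suc b)} _ _ shape =
    subst StrictlyLogConcave (sym sequence)
      (logConcave⇒strictlyLogConcave (λ j → f (1 + j)) (pascalⁿ-logConcave (single-term-logConcave (s≤s z≤n)) b)
        (s≤s (ℕₚ.≤-reflexive (sym (ℕₚ.+-identityʳ b)))) coefficient)
    where
    f = λ i → coeffA P 1 (2 + b) i (1 + (2 + b) ∸ 2 ∸ i)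
    slice : w-slice 1 (P 1 (2 + b)) ≋ (T ^ b) (lin 0ℤ (ℤ.+ suc b))
    slice = ^-injective T-injective 3 (order₁ shape)
    sequence : seq2 P 1 (2 + b) ≡ applyUpTo (λ j → f (1 + j)) (suc b)
    sequence = trans (cong (map f) (line2-interval₁ (s≤s (s≤s z≤n)))) (map-applyUpTo (1 +_) f (suc b))
    coefficient : ∀ j → j < suc b → f (1 + j) ≡ ℤ.+ pascalⁿ b (two-terms (suc b) 0) j
    coefficient j (s≤s j≤b) = begin
      P 1 (2 + b) (1 + j) (b ∸ j) ((suc b ∸ j) ∸ (b ∸ j))
        ≡⟨ cong (P 1 (2 + b) (1 + j) (b ∸ j)) ([1+n∸i]∸[n∸i]≡1 b j j≤b) ⟩
      w-slice 1 (P 1 (2 + b)) (1 + j) (b ∸ j)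
        ≡⟨ at (≋-trans slice (Tᵇ.resp-≋ (lin-0 _))) (1 + j) (b ∸ j) ⟩
      (T ^ b) (U (const (ℤ.+ suc b))) (1 + j) (b ∸ j)
        ≡⟨ at (multipliers-commute (^-isMultiplier T-isMultiplier b) U-isMultiplier _) (1 + j) (b ∸ j) ⟩
      (T ^ b) (const (ℤ.+ suc b)) j (b ∸ j)
        ≡⟨ T^-antidiagonal (const-antidiagonal (suc b)) vanishes b j (b ∸ j)
                           (trans (ℕₚ.m+[n∸m]≡n j≤b) (sym (ℕₚ.+-identityʳ b))) ⟩
      ℤ.+ pascalⁿ b (two-terms (suc b) 0) j ∎
      where
      open ≡-Reasoning
      module Tᵇ = IsMultiplier (^-isMultiplier T-isMultiplier b)
      vanishes : ∀ {j} → 0 < j → two-terms (suc b) 0 j ≡ 0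
      vanishes {suc zero}    _ = refl
      vanishes {suc (suc j)} _ = refl
  seq2-strictlyLogConcave {suc (suc a)} {suc b} _ (s≤s a<b) shape =
    subst StrictlyLogConcave (sym sequence)
      (logConcave⇒strictlyLogConcave f (pascalⁿ-logConcave (two-terms-logConcave (s≤s z≤n) β′>0) m)
        (ℕₚ.≤-reflexive (cong suc (trans n≡1+m (ℕₚ.+-comm 1 m)))) coefficient)
    where
    n = a + suc b
    m = a + b
    n≡1+m : n ≡ suc m
    n≡1+m = ℕₚ.+-suc a b
    β′>0 : 0 < b
    β′>0 = ℕₚ.<-≤-trans (s≤s z≤n) a<b
    f = λ i → coeffA P (2 + a) (suc b) i (2 + a + suc b ∸ 2 ∸ i)
    slice : w-slice 1 (P (2 + a) (suc b)) ≋ (T ^ m) (lin (ℤ.+ suc a) (ℤ.+ b))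
    slice = ^-injective T-injective 3 (≋-trans (order₁ shape) (UT-≡ {0} (lin (ℤ.+ suc a) (ℤ.+ b)) refl (cong (2 +_) n≡1+m)))
    sequence : seq2 P (2 + a) (suc b) ≡ applyUpTo f (suc n)
    sequence = trans (cong (map f) (line2-interval (s≤s (s≤s z≤n)) (ℕₚ.<⇒≤ (s≤s a<b)))) (map-applyUpTo (0 +_) f (suc n))
    coefficient : ∀ i → i < suc n → f i ≡ ℤ.+ pascalⁿ m (two-terms (suc a) b) i
    coefficient i (s≤s i≤n) = begin
      P (2 + a) (suc b) i (n ∸ i) ((suc n ∸ i) ∸ (n ∸ i))
        ≡⟨ cong (P (2 + a) (suc b) i (n ∸ i)) ([1+n∸i]∸[n∸i]≡1 n i i≤n) ⟩
      w-slice 1 (P (2 + a) (suc b)) i (n ∸ i)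
        ≡⟨ at slice i (n ∸ i) ⟩
      (T ^ m) (lin (ℤ.+ suc a) (ℤ.+ b)) i (n ∸ i)
        ≡⟨ T^-antidiagonal (lin-antidiagonal (suc a) b) vanishes m i (n ∸ i)
                           (trans (ℕₚ.m+[n∸m]≡n i≤n) (trans n≡1+m (ℕₚ.+-comm 1 m))) ⟩
      ℤ.+ pascalⁿ m (two-terms (suc a) b) i ∎
      where
      open ≡-Reasoning
      vanishes : ∀ {j} → 1 < j → two-terms (suc a) b j ≡ 0
      vanishes {suc zero}    (s≤s ())
      vanishes {suc (suc j)} _ = refl

theorem6p6 : (P : ℕ → ℕ → Ser) → IsMarkovNumerators P →
    (a b : ℕ) → Coprime a b → 1 ≤ a → a ≤ b →
    StrictlyLogConcave (seq1 P a b) × StrictlyLogConcave (seq2 P a b)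
theorem6p6 P H a b a⊥b 1≤a a≤b with ℕₚ.m≤n⇒m<n∨m≡n a≤b
... | inj₂ refl with a⊥b (∣-refl , ∣-refl)
...   | refl = tt , tt
theorem6p6 P H a b a⊥b 1≤a a≤b | inj₁ a<b =
  seq1-strictlyLogConcave 1≤a a<b (at-mediant {Line₁.ShapeAt} Line₁.shape) ,
  seq2-strictlyLogConcave 1≤a a<b (at-mediant {Line₂.ShapeAt} Line₂.shape)
  where
  open Markov P H
  open MediantOf (coprime-mediant-below-one a⊥b 1≤a a<b)
  at-mediant : {S : ℕ → ℕ → Set} → (∀ {p q r s} → Descendant 0 1 1 1 p q r s → S (p + r) (q + s)) → S a b
  at-mediant {S} shape = subst₂ S numerator denominator (shape descendant)
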